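{- Let $n,k,d$ be non-negative integers with $n\geq 2$, and let $G$ be an $(n,k,d)$-graph. Then for an edge $uv\in E(G)$, the graph $G-uv$ is not an $(n-2,k,d)$-graph if and only if there exists a vertex subset $S\subseteq V(G)$ with $|S|=n-2+2k$ such that $G[S]$ contains a $k$-matching and $G-S$ is the disjoint union of $d$ odd components, each of which is factor-critical, together with one further component consisting of the single edge $uv$ (i.e., the subgraph on $\{u,v\}$ with edge $uv$).
   Context: All graphs are finite, undirected and simple. $G[S]$ is the subgraph induced by $S$ and $G-S$ is the subgraph induced by $V(G)\setminus S$. A $k$-matching is a matching with exactly $k$ edges. For a non-negative integer $d$, a defect-$d$ matching of a graph $H$ is a matching covering exactly $|V(H)|-d$ vertices of $H$. A matching $M$ extends to a matching $M'$ if $M\subseteq M'$. A graph is factor-critical if deleting any one of its vertices leaves a graph with a perfect matching (a single vertex is factor-critical). Let $n,k,d$ be non-negative integers. A graph $G$ is an $(n,k,d)$-graph if $|V(G)|\geq n+2k+d+2$, $|V(G)|-n-d$ is even, and for every set $S$ of $n$ vertices of $G$, the graph $H=G-S$ contains a $k$-matching and every $k$-matching of $H$ can be extended to a defect-$d$ matching of $H$. -}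

module Defs where

open import Data.Nat using (ℕ; _+_; _*_; _∸_; _≤_)
open import Data.Nat.Divisibility using (_∣_)
open import Data.Bool using (Bool; true; false; _∧_; not; _∨_)
open import Data.Fin using (Fin; _≟_)
open import Data.Fin.Subset using (Subset; _∈_; _∉_; ∣_∣; ∁; ⁅_⁆; _∪_; _∩_; Empty)
open import Data.Product using (Σ; ∃; _×_; _,_; proj₁; proj₂)
open import Data.List using (List; []; _∷_; length; concatMap)
open import Data.List.Relation.Unary.All using (All)
open import Data.List.Relation.Unary.Unique.Propositional using (Unique)
import Data.List.Membership.Propositional as LM
open import Data.Sum using (_⊎_)
open import Data.Vec using (Vec; lookup; _∷_)
open import Relation.Binary.PropositionalEquality using (_≡_; _≢_)
open import Relation.Nullary using (¬_; ⌊_⌋)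

record Graph (N : ℕ) : Set where
  field
    adj   : Fin N → Fin N → Bool
    sym   : ∀ x y → adj x y ≡ adj y x
    irrefl : ∀ x → adj x x ≡ false
open Graph public

Edge : ∀ {N} → Graph N → Fin N → Fin N → Set
Edge G x y = adj G x y ≡ true

sameEdge : ∀ {N} → Fin N → Fin N → Fin N → Fin N → Bool
sameEdge u v x y = (⌊ x ≟ u ⌋ ∧ ⌊ y ≟ v ⌋) ∨ (⌊ x ≟ v ⌋ ∧ ⌊ y ≟ u ⌋)

deleteEdge : ∀ {N} → Graph N → Fin N → Fin N → Graph N
deleteEdge {N} G u v = record
  { adj = λ x y → adj G x y ∧ not (sameEdge u v x y)
  ; sym = symm
  ; irrefl = irr }
  where
  lemS : ∀ x y → sameEdge u v x y ≡ sameEdge u v y x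
  lemS x y with x ≟ u | y ≟ v | x ≟ v | y ≟ u
  ... | Relation.Nullary.yes _ | Relation.Nullary.yes _ | Relation.Nullary.yes _ | Relation.Nullary.yes _ = _≡_.refl
  ... | Relation.Nullary.yes _ | Relation.Nullary.yes _ | Relation.Nullary.yes _ | Relation.Nullary.no _ = _≡_.refl
  ... | Relation.Nullary.yes _ | Relation.Nullary.yes _ | Relation.Nullary.no _ | Relation.Nullary.yes _ = _≡_.refl
  ... | Relation.Nullary.yes _ | Relation.Nullary.yes _ | Relation.Nullary.no _ | Relation.Nullary.no _ = _≡_.refl
  ... | Relation.Nullary.yes _ | Relation.Nullary.no _ | Relation.Nullary.yes _ | Relation.Nullary.yes _ = _≡_.refl
  ... | Relation.Nullary.yes _ | Relation.Nullary.no _ | Relation.Nullary.yes _ | Relation.Nullary.no _ = _≡_.refl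
  ... | Relation.Nullary.yes _ | Relation.Nullary.no _ | Relation.Nullary.no _ | Relation.Nullary.yes _ = _≡_.refl
  ... | Relation.Nullary.yes _ | Relation.Nullary.no _ | Relation.Nullary.no _ | Relation.Nullary.no _ = _≡_.refl
  ... | Relation.Nullary.no _ | Relation.Nullary.yes _ | Relation.Nullary.yes _ | Relation.Nullary.yes _ = _≡_.refl
  ... | Relation.Nullary.no _ | Relation.Nullary.yes _ | Relation.Nullary.yes _ | Relation.Nullary.no _ = _≡_.refl
  ... | Relation.Nullary.no _ | Relation.Nullary.yes _ | Relation.Nullary.no _ | Relation.Nullary.yes _ = _≡_.refl
  ... | Relation.Nullary.no _ | Relation.Nullary.yes _ | Relation.Nullary.no _ | Relation.Nullary.no _ = _≡_.refl
  ... | Relation.Nullary.no _ | Relation.Nullary.no _ | Relation.Nullary.yes _ | Relation.Nullary.yes _ = _≡_.refl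
  ... | Relation.Nullary.no _ | Relation.Nullary.no _ | Relation.Nullary.yes _ | Relation.Nullary.no _ = _≡_.refl
  ... | Relation.Nullary.no _ | Relation.Nullary.no _ | Relation.Nullary.no _ | Relation.Nullary.yes _ = _≡_.refl
  ... | Relation.Nullary.no _ | Relation.Nullary.no _ | Relation.Nullary.no _ | Relation.Nullary.no _ = _≡_.refl
  symm : ∀ x y → (adj G x y ∧ not (sameEdge u v x y)) ≡ (adj G y x ∧ not (sameEdge u v y x))
  symm x y rewrite sym G x y | lemS x y = _≡_.refl
  irr : ∀ x → (adj G x x ∧ not (sameEdge u v x x)) ≡ false
  irr x rewrite irrefl G x = _≡_.refl

-- Matchings are lists of (ordered pairs representing) edges.
endpoints : ∀ {N} → List (Fin N × Fin N) → List (Fin N)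
endpoints = concatMap (λ e → proj₁ e ∷ proj₂ e ∷ [])

IsMatching : ∀ {N} → Graph N → Subset N → List (Fin N × Fin N) → Set
IsMatching G W M =
  All (λ e → Edge G (proj₁ e) (proj₂ e) × proj₁ e ∈ W × proj₂ e ∈ W) M
  × Unique (endpoints M)

IsKMatching : ∀ {N} → Graph N → Subset N → ℕ → List (Fin N × Fin N) → Set
IsKMatching G W k M = IsMatching G W M × length M ≡ k

-- A defect-d matching of G[W]: covers exactly |W| - d vertices
-- (a matching covers 2·|M| vertices).
IsDefectMatching : ∀ {N} → Graph N → Subset N → ℕ → List (Fin N × Fin N) → Set
IsDefectMatching G W d M = IsMatching G W M × 2 * length M + d ≡ ∣ W ∣

swapE : ∀ {N} → Fin N × Fin N → Fin N × Fin N
swapE (x , y) = (y , x)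

-- M ⊆ M' as sets of (unordered) edges
Extends : ∀ {N} → List (Fin N × Fin N) → List (Fin N × Fin N) → Set
Extends M M' = All (λ e → e LM.∈ M' ⊎ swapE e LM.∈ M') M

-- G - S, the graph induced by the complement of S, is represented by its vertex set ∁ S.
-- (n,k,d)-graph
IsNKDGraph : ℕ → ℕ → ℕ → ∀ {N} → Graph N → Set
IsNKDGraph n k d {N} G =
  n + 2 * k + d + 2 ≤ N
  × 2 ∣ (N ∸ n ∸ d)
  × (∀ (S : Subset N) → ∣ S ∣ ≡ n →
       (∃ λ M → IsKMatching G (∁ S) k M)
       × (∀ M → IsKMatching G (∁ S) k M →
            ∃ λ M' → IsDefectMatching G (∁ S) d M' × Extends M M'))

data Reach {N} (G : Graph N) (C : Subset N) : Fin N → Fin N → Set where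
  here : ∀ {x} → Reach G C x x
  step : ∀ {x y z} → Edge G x y → y ∈ C → Reach G C y z → Reach G C x z

Connected : ∀ {N} → Graph N → Subset N → Set
Connected G C = ∀ x y → x ∈ C → y ∈ C → Reach G C x y

IsComponent : ∀ {N} → Graph N → Subset N → Subset N → Set
IsComponent G W C =
  (∀ x → x ∈ C → x ∈ W)
  × (∃ λ x → x ∈ C)
  × Connected G C
  × (∀ x y → x ∈ C → y ∈ W → y ∉ C → ¬ Edge G x y)

FactorCritical : ∀ {N} → Graph N → Subset N → Set
FactorCritical G C =
  ∀ v → v ∈ C → ∃ λ M → IsMatching G (C ∩ ∁ ⁅ v ⁆) M × 2 * length M ≡ ∣ C ∩ ∁ ⁅ v ⁆ ∣

Odd : ℕ → Set
Odd m = ¬ (2 ∣ m)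

DisjointUnionOfComponents : ∀ {N m} → Graph N → Subset N → Vec (Subset N) m → Set
DisjointUnionOfComponents G W parts =
  (∀ i → IsComponent G W (lookup parts i))
  × (∀ i j → i ≢ j → Empty (lookup parts i ∩ lookup parts j))
  × (∀ x → x ∈ W → ∃ λ i → x ∈ lookup parts i)

module Submission where

-- If G - uv is not an (n - 2, k, d)-graph, some set S₀ of n - 2 vertices and k-matching M of G - uv - S₀
-- admit no extension of defect d. Let T be the vertices outside S₀ and V(M). Because G is an
-- (n, k, d)-graph, M extends in G once S₀ and any two vertices x, y of T are deleted, so G[T - x - y] has a
-- matching of defect d, while G[T] - uv has none. Adding a single edge shows that u and v lie in T and have
-- no other neighbours there; then G[T - u - v] has maximum matchings of defect d missing any prescribed
-- vertex, and Gallai's lemma (proved with alternating paths) splits it into d factor-critical components.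
-- With S = S₀ ∪ V(M) this is the stated structure. Conversely, from such an S delete S₀ = S - V(M): a
-- defect-d extension of M would have to miss u, v and a vertex of every odd component, d + 2 in all.

open import Defs renaming (sym to adj-sym)
open import Data.Nat using (ℕ; zero; suc; _+_; _*_; _∸_; _≤_; _<_; z≤n; s≤s; s≤s⁻¹; _≤?_)
open import Data.Nat.Properties renaming (_≟_ to _≟ℕ_)
open import Data.Nat.Divisibility using (_∣_; divides; ∣m+n∣m⇒∣n; ∣1⇒≡1; n∣n; ∣m∣n⇒∣m+n)
open import Data.Nat.Tactic.RingSolver using (solve-∀)
open import Data.Bool using (Bool; true; false; _∧_; _∨_; not; if_then_else_)
open import Data.Bool.Properties using (∧-zeroʳ; ∧-identityʳ; ∧-assoc; ∨-identityʳ; ∨-zeroʳ; not-involutive) renaming (_≟_ to _≟ᵇ_)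
open import Data.Maybe using (Maybe; just; nothing; is-just)
open import Data.Maybe.Properties using (just-injective) renaming (≡-dec to ≡-decᵐ)
open import Data.Fin using (Fin; zero; suc; _≟_; toℕ)
open import Data.Fin.Properties using (any?; pigeonhole) renaming (suc-injective to fsuc-injective; 0≢1+n to fzero≢fsuc)
open import Data.Fin.Subset using (Subset; _∈_; _∉_; ∣_∣; ∁; ⁅_⁆; _∪_; _∩_; Empty)
open import Data.Fin.Subset.Properties using (x∈p∪q⁺; x∈p∪q⁻; x∈⁅x⁆; x∈⁅y⁆⇒x≡y; x∈p∩q⁺; x∈p∩q⁻; anySubset?; ∣p∣≤n; ∣∁p∣≡n∸∣p∣) renaming (_∈?_ to _∈ˢ?_)
open import Data.Vec using (Vec; []; _∷_; lookup; tabulate)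
open import Data.Vec.Properties using ([]=⇒lookup; lookup⇒[]=; lookup-map; lookup-zipWith; lookup∘tabulate)
open import Data.Product using (Σ; ∃; _×_; _,_; proj₁; proj₂)
open import Data.Product.Properties using () renaming (≡-dec to ≡-dec×)
open import Data.Sum using (_⊎_; inj₁; inj₂)
open import Data.Empty using (⊥; ⊥-elim)
open import Data.List using (List; []; _∷_; length; _++_; map; concatMap; cartesianProduct; allFin)
open import Data.List.Properties using (length-++)
open import Data.List.Relation.Unary.All using (All; []; _∷_)
import Data.List.Relation.Unary.All as All
open import Data.List.Relation.Unary.All.Properties using () renaming (++⁺ to All-++⁺)
open import Data.List.Relation.Unary.Any using (here; there)
import Data.List.Relation.Unary.Any as Any
open import Data.List.Relation.Unary.AllPairs using ([]; _∷_)
open import Data.List.Relation.Unary.Unique.Propositional using (Unique)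
import Data.List.Relation.Unary.Unique.Propositional.Properties as Unique
import Data.List.Membership.Propositional as Mem
open import Data.List.Membership.Propositional.Properties using (∈-cartesianProduct⁺; ∈-allFin; ∈-map⁺; ∈-concatMap⁺; ∈-++⁺ˡ)
open import Function.Bundles using (_⇔_; mk⇔)
open import Relation.Binary.PropositionalEquality
open import Relation.Nullary using (¬_; yes; no; ⌊_⌋; Dec; _×-dec_; _⊎-dec_; ¬?)
open import Relation.Unary using (Decidable)

true≢false : true ≢ false
true≢false ()

nothing≢just : ∀ {A : Set} {a : A} → nothing ≢ just a
nothing≢just ()

∧-trueˡ : ∀ {a b} → a ∧ b ≡ true → a ≡ true
∧-trueˡ {true} _ = refl

∧-trueʳ : ∀ {a b} → a ∧ b ≡ true → b ≡ true
∧-trueʳ {true} h = h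

∧-true : ∀ {a b} → a ≡ true → b ≡ true → a ∧ b ≡ true
∧-true refl refl = refl

not-true : ∀ {b} → not b ≡ true → b ≡ false
not-true {false} _ = refl

module _ {N : ℕ} where

  _==_ : Fin N → Fin N → Bool
  x == y = ⌊ x ≟ y ⌋

  ==-refl : ∀ x → x == x ≡ true
  ==-refl x with x ≟ x
  ... | yes _ = refl
  ... | no x≢x = ⊥-elim (x≢x refl)

  ==-true : ∀ {x y} → x == y ≡ true → x ≡ y
  ==-true {x} {y} h with x ≟ y
  ... | yes x≡y = x≡y

  ==-false : ∀ {x y} → x ≢ y → x == y ≡ false
  ==-false {x} {y} x≢y with x ≟ y
  ... | yes x≡y = ⊥-elim (x≢y x≡y)
  ... | no _ = refl

indicator : Bool → ℕ
indicator true = 1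
indicator false = 0

count : ∀ {N} → (Fin N → Bool) → ℕ
count {zero} f = 0
count {suc N} f = indicator (f zero) + count (λ x → f (suc x))

count-cong : ∀ {N} {f g : Fin N → Bool} → (∀ x → f x ≡ g x) → count f ≡ count g
count-cong {zero} _ = refl
count-cong {suc N} f≗g = cong₂ _+_ (cong indicator (f≗g zero)) (count-cong (λ x → f≗g (suc x)))

count-none : ∀ {N} (f : Fin N → Bool) → (∀ x → f x ≡ false) → count f ≡ 0
count-none {zero} f _ = refl
count-none {suc N} f none rewrite none zero = count-none _ (λ x → none (suc x))

count≤N : ∀ {N} (f : Fin N → Bool) → count f ≤ N
count≤N {zero} f = z≤n
count≤N {suc N} f with f zero
... | true = s≤s (count≤N _)
... | false = m≤n⇒m≤1+n (count≤N _)

indicator-split : ∀ a b → indicator a ≡ indicator (a ∧ b) + indicator (a ∧ not b)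
indicator-split true true = refl
indicator-split true false = refl
indicator-split false b = refl

count-split : ∀ {N} (f g : Fin N → Bool) →
  count f ≡ count (λ x → f x ∧ g x) + count (λ x → f x ∧ not (g x))
count-split {zero} f g = refl
count-split {suc N} f g =
  trans (cong₂ _+_ (indicator-split (f zero) (g zero)) (count-split _ (λ x → g (suc x))))
    (interchange (indicator (f zero ∧ g zero)) (indicator (f zero ∧ not (g zero)))
                 (count (λ x → f (suc x) ∧ g (suc x))) (count (λ x → f (suc x) ∧ not (g (suc x)))))
  where
  interchange : ∀ a b c d → (a + b) + (c + d) ≡ (a + c) + (b + d)
  interchange = solve-∀

count-partition : ∀ {N} (f g p q : Fin N → Bool) →
  (∀ x → f x ∧ g x ≡ p x) → (∀ x → f x ∧ not (g x) ≡ q x) → count f ≡ count p + count q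
count-partition f g p q f∧g≗p f∧¬g≗q =
  trans (count-split f g) (cong₂ _+_ (count-cong f∧g≗p) (count-cong f∧¬g≗q))

indicator-mono : ∀ a b → (a ≡ true → b ≡ true) → indicator a ≤ indicator b
indicator-mono true b a⇒b rewrite a⇒b refl = ≤-refl
indicator-mono false b _ = z≤n

count-mono : ∀ {N} (f g : Fin N → Bool) → (∀ x → f x ≡ true → g x ≡ true) → count f ≤ count g
count-mono {zero} f g _ = z≤n
count-mono {suc N} f g f⇒g =
  +-mono-≤ (indicator-mono _ _ (f⇒g zero)) (count-mono _ _ (λ x → f⇒g (suc x)))

count-mono-< : ∀ {N} (f g : Fin N → Bool) → (∀ x → f x ≡ true → g x ≡ true) →
  (z : Fin N) → f z ≡ false → g z ≡ true → count f < count g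
count-mono-< f g f⇒g zero fz gz rewrite fz | gz = s≤s (count-mono _ _ (λ x → f⇒g (suc x)))
count-mono-< f g f⇒g (suc z) fz gz =
  +-mono-≤-< (indicator-mono _ _ (f⇒g zero)) (count-mono-< _ _ (λ x → f⇒g (suc x)) z fz gz)

count-singleton : ∀ {N} (z : Fin N) → count (_== z) ≡ 1
count-singleton {suc N} zero = cong suc (count-none {N} _ (λ _ → refl))
count-singleton {suc N} (suc z) = trans (count-cong ==-suc) (count-singleton z)
  where
  ==-suc : ∀ x → (suc x == suc z) ≡ (x == z)
  ==-suc x with x ≟ z
  ... | yes refl = refl
  ... | no _ = refl

count-remove : ∀ {N} (f : Fin N → Bool) (z : Fin N) → f z ≡ true →
  count f ≡ suc (count (λ x → f x ∧ not (x == z)))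
count-remove f z fz =
  trans (count-split f (_== z)) (cong (_+ count (λ x → f x ∧ not (x == z))) (trans (count-cong f∧==z) (count-singleton z)))
  where
  f∧==z : ∀ x → f x ∧ (x == z) ≡ (x == z)
  f∧==z x with x ≟ z
  ... | yes refl = trans (∧-identityʳ _) fz
  ... | no _ = ∧-zeroʳ _

count-witness : ∀ {N} (f : Fin N → Bool) → 0 < count f → ∃ λ x → f x ≡ true
count-witness {suc N} f 0<count with f zero in f0
... | true = zero , f0
... | false with count-witness (λ x → f (suc x)) 0<count
... | x , fx = suc x , fx

count-∨ : ∀ {N} (f g : Fin N → Bool) → (∀ x → f x ∧ g x ≡ false) →
  count (λ x → f x ∨ g x) ≡ count f + count g
count-∨ f g disjoint = count-partition (λ x → f x ∨ g x) f f g ∨-∧ˡ ∨-∧¬ˡ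
  where
  ∨-∧ˡ : ∀ x → (f x ∨ g x) ∧ f x ≡ f x
  ∨-∧ˡ x with f x
  ... | true = refl
  ... | false = ∧-zeroʳ _
  ∨-∧¬ˡ : ∀ x → (f x ∨ g x) ∧ not (f x) ≡ g x
  ∨-∧¬ˡ x with f x in fx | g x in gx
  ... | true | true = ⊥-elim (true≢false (trans (sym (cong₂ _∧_ fx gx)) (disjoint x)))
  ... | true | false = refl
  ... | false | _ = ∧-identityʳ _

count-injection : ∀ {N} m (f : Fin N → Bool) (g : Fin m → Fin N) →
  (∀ i j → g i ≡ g j → i ≡ j) → (∀ i → f (g i) ≡ true) → m ≤ count f
count-injection zero f g _ _ = z≤n
count-injection (suc m) f g g-inj fg =
  subst (suc m ≤_) (sym (count-remove f (g zero) (fg zero)))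
    (s≤s (count-injection m _ (λ i → g (suc i)) (λ i j e → fsuc-injective (g-inj _ _ e)) fg′))
  where
  fg′ : ∀ i → f (g (suc i)) ∧ not (g (suc i) == g zero) ≡ true
  fg′ i rewrite fg (suc i) | ==-false {x = g (suc i)} {g zero} (λ e → fzero≢fsuc (sym (g-inj _ _ e))) = refl

enumerate : ∀ {N} (f : Fin N → Bool) → Σ (Fin (count f) → Fin N) λ g →
  (∀ i j → g i ≡ g j → i ≡ j) × (∀ i → f (g i) ≡ true) × (∀ y → f y ≡ true → ∃ λ i → g i ≡ y)
enumerate {zero} f = (λ ()) , (λ ()) , (λ ()) , (λ ())
enumerate {suc N} f with f zero in f0 | enumerate (λ x → f (suc x))
... | true | (g , g-inj , g-in , g-onto) = g′ , g′-inj , g′-in , g′-onto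
  where
  g′ : Fin (suc (count (λ x → f (suc x)))) → Fin (suc N)
  g′ zero = zero
  g′ (suc i) = suc (g i)
  g′-inj : ∀ i j → g′ i ≡ g′ j → i ≡ j
  g′-inj zero zero _ = refl
  g′-inj (suc i) (suc j) e = cong suc (g-inj i j (fsuc-injective e))
  g′-in : ∀ i → f (g′ i) ≡ true
  g′-in zero = f0
  g′-in (suc i) = g-in i
  g′-onto : ∀ y → f y ≡ true → ∃ λ i → g′ i ≡ y
  g′-onto zero _ = zero , refl
  g′-onto (suc y) fy with g-onto y fy
  ... | i , refl = suc i , refl
... | false | (g , g-inj , g-in , g-onto) =
  (λ i → suc (g i)) , (λ i j e → g-inj i j (fsuc-injective e)) , g-in , g′-onto
  where
  g′-onto : ∀ y → f y ≡ true → ∃ λ i → suc (g i) ≡ y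
  g′-onto zero fy = ⊥-elim (true≢false (trans (sym fy) f0))
  g′-onto (suc y) fy with g-onto y fy
  ... | i , refl = i , refl

module _ {N : ℕ} where

  ∈⇒true : ∀ {x : Fin N} {p : Subset N} → x ∈ p → lookup p x ≡ true
  ∈⇒true = []=⇒lookup

  true⇒∈ : ∀ {x : Fin N} {p : Subset N} → lookup p x ≡ true → x ∈ p
  true⇒∈ {x} {p} = lookup⇒[]= x p

  false⇒∉ : ∀ {x : Fin N} {p : Subset N} → lookup p x ≡ false → x ∉ p
  false⇒∉ p[x]≡false x∈p = true≢false (trans (sym (∈⇒true x∈p)) p[x]≡false)

  lookup-∁ : ∀ (p : Subset N) x → lookup (∁ p) x ≡ not (lookup p x)
  lookup-∁ p x = lookup-map x not p

  lookup-∩ : ∀ (p q : Subset N) x → lookup (p ∩ q) x ≡ lookup p x ∧ lookup q x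
  lookup-∩ p q x = lookup-zipWith _∧_ x p q

  ∈∁⇒false : ∀ {x} {p : Subset N} → x ∈ ∁ p → lookup p x ≡ false
  ∈∁⇒false {x} {p} x∈∁p = not-true (trans (sym (lookup-∁ p x)) (∈⇒true x∈∁p))

∣∣≡count : ∀ {N} (p : Subset N) → ∣ p ∣ ≡ count (lookup p)
∣∣≡count [] = refl
∣∣≡count (true ∷ p) = cong suc (∣∣≡count p)
∣∣≡count (false ∷ p) = ∣∣≡count p

lookup-⁅⁆ : ∀ {N} (u x : Fin N) → lookup ⁅ u ⁆ x ≡ (x == u)
lookup-⁅⁆ zero zero = refl
lookup-⁅⁆ zero (suc x) = lookup-replicate x
  where
  lookup-replicate : ∀ {m} (i : Fin m) → lookup (Data.Vec.replicate m false) i ≡ false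
  lookup-replicate zero = refl
  lookup-replicate (suc i) = lookup-replicate i
lookup-⁅⁆ (suc u) zero = refl
lookup-⁅⁆ (suc u) (suc x) with x ≟ u | lookup-⁅⁆ u x
... | yes refl | h = h
... | no _ | h = h

lookup-∩∁⁅⁆ : ∀ {N} (C : Subset N) w x → lookup (C ∩ ∁ ⁅ w ⁆) x ≡ lookup C x ∧ not (x == w)
lookup-∩∁⁅⁆ C w x = trans (lookup-∩ C (∁ ⁅ w ⁆) x) (cong (lookup C x ∧_) (trans (lookup-∁ ⁅ w ⁆ x) (cong not (lookup-⁅⁆ w x))))

∣∣-remove : ∀ {N} (C : Subset N) {w} → w ∈ C → ∣ C ∣ ≡ suc ∣ C ∩ ∁ ⁅ w ⁆ ∣
∣∣-remove C {w} w∈C = trans (∣∣≡count C) (trans (count-remove (lookup C) w (∈⇒true w∈C))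
  (cong suc (trans (count-cong (λ x → sym (lookup-∩∁⁅⁆ C w x))) (sym (∣∣≡count (C ∩ ∁ ⁅ w ⁆))))))

avoiding : ∀ {N} → Fin N → Fin N → Fin N → Bool
avoiding x y z = not (z == x) ∧ not (z == y)

avoiding-left : ∀ {N} (x y : Fin N) → avoiding x y x ≡ false
avoiding-left x y rewrite ==-refl x = refl

addTwo : ∀ {N} → Subset N → Fin N → Fin N → Subset N
addTwo S x y = tabulate (λ z → (lookup S z ∨ (z == x)) ∨ (z == y))

module _ {N} (S : Subset N) {x y : Fin N} where

  lookup-∁addTwo : ∀ z → lookup (∁ (addTwo S x y)) z ≡ not (lookup S z) ∧ avoiding x y z
  lookup-∁addTwo z = trans (lookup-∁ (addTwo S x y) z) (trans (cong not (lookup∘tabulate _ z))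
    (de-Morgan (lookup S z) (z == x) (z == y)))
    where
    de-Morgan : ∀ a b c → not ((a ∨ b) ∨ c) ≡ not a ∧ (not b ∧ not c)
    de-Morgan true b c = refl
    de-Morgan false true c = refl
    de-Morgan false false c = refl

  ∣addTwo∣ : lookup S x ≡ false → lookup S y ≡ false → x ≢ y → ∣ addTwo S x y ∣ ≡ ∣ S ∣ + 2
  ∣addTwo∣ Sx Sy x≢y = begin
      ∣ addTwo S x y ∣
    ≡⟨ trans (∣∣≡count (addTwo S x y)) (count-cong (lookup∘tabulate (λ z → (lookup S z ∨ (z == x)) ∨ (z == y)))) ⟩
      count (λ z → (lookup S z ∨ (z == x)) ∨ (z == y))
    ≡⟨ count-∨ _ _ y-new ⟩
      count (λ z → lookup S z ∨ (z == x)) + count (_== y)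
    ≡⟨ cong₂ _+_ (count-∨ _ _ x-new) (count-singleton y) ⟩
      (count (lookup S) + count (_== x)) + 1
    ≡⟨ cong (λ c → (c + count (_== x)) + 1) (sym (∣∣≡count S)) ⟩
      (∣ S ∣ + count (_== x)) + 1
    ≡⟨ cong (λ c → (∣ S ∣ + c) + 1) (count-singleton x) ⟩
      (∣ S ∣ + 1) + 1
    ≡⟨ +-assoc ∣ S ∣ 1 1 ⟩
      ∣ S ∣ + 2
    ∎
    where
    open ≡-Reasoning
    x-new : ∀ z → lookup S z ∧ (z == x) ≡ false
    x-new z with z ≟ x
    ... | yes refl = trans (∧-identityʳ _) Sx
    ... | no _ = ∧-zeroʳ _
    y-new : ∀ z → (lookup S z ∨ (z == x)) ∧ (z == y) ≡ false
    y-new z with z ≟ y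
    ... | yes refl rewrite Sy | ==-false {x = z} {x} (λ e → x≢y (sym e)) = refl
    ... | no _ = ∧-zeroʳ _

∣p∣+∣∁p∣≡n : ∀ {N} (p : Subset N) → ∣ p ∣ + ∣ ∁ p ∣ ≡ N
∣p∣+∣∁p∣≡n p = trans (cong (∣ p ∣ +_) (∣∁p∣≡n∸∣p∣ p)) (m+[n∸m]≡n (∣p∣≤n p))

-- Matchings as mate functions

adj-irrefl : ∀ {N} (G : Graph N) {a b} → adj G a b ≡ true → a ≢ b
adj-irrefl G e refl = true≢false (trans (sym e) (irrefl G _))

record Matching {N} (H : Graph N) (W : Fin N → Bool) : Set where
  field
    mate : Fin N → Maybe (Fin N)
    mate-sym : ∀ {x y} → mate x ≡ just y → mate y ≡ just x
    mate-adj : ∀ {x y} → mate x ≡ just y → adj H x y ≡ true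
    mate-in : ∀ {x y} → mate x ≡ just y → W x ≡ true
open Matching public

module _ {N} {H : Graph N} {W : Fin N → Bool} where

  covered : Matching H W → Fin N → Bool
  covered m x = is-just (mate m x)

  covered⇒mate : (m : Matching H W) {x : Fin N} → covered m x ≡ true → ∃ λ y → mate m x ≡ just y
  covered⇒mate m {x} c with mate m x
  ... | just y = y , refl

  mate⇒covered : (m : Matching H W) {x y : Fin N} → mate m x ≡ just y → covered m x ≡ true
  mate⇒covered m e rewrite e = refl

  uncovered⇒nothing : (m : Matching H W) {x : Fin N} → covered m x ≡ false → mate m x ≡ nothing
  uncovered⇒nothing m {x} c with mate m x
  ... | nothing = refl

  nothing⇒uncovered : (m : Matching H W) {x : Fin N} → mate m x ≡ nothing → covered m x ≡ false
  nothing⇒uncovered m e rewrite e = refl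

  mate-irrefl : (m : Matching H W) {x y : Fin N} → mate m x ≡ just y → x ≢ y
  mate-irrefl m e = adj-irrefl H (mate-adj m e)

  covered⇒in : (m : Matching H W) {x : Fin N} → covered m x ≡ true → W x ≡ true
  covered⇒in m c = mate-in m (proj₂ (covered⇒mate m c))

  mate-covered : (m : Matching H W) {x y : Fin N} → mate m x ≡ just y → covered m y ≡ true
  mate-covered m e = mate⇒covered m (mate-sym m e)

  ncovered : Matching H W → ℕ
  ncovered m = count (covered m)

transfer : ∀ {N} {H H′ : Graph N} {W W′ : Fin N → Bool} (m : Matching H W) →
  (∀ {x y} → mate m x ≡ just y → adj H′ x y ≡ true) →
  (∀ {x y} → mate m x ≡ just y → W′ x ≡ true) → Matching H′ W′
transfer m adj′ in′ = record { mate = mate m ; mate-sym = mate-sym m ; mate-adj = adj′ ; mate-in = in′ }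

module _ {N} {H : Graph N} {W : Fin N → Bool} where

  addEdge : (m : Matching H W) (a b : Fin N) → mate m a ≡ nothing → mate m b ≡ nothing → a ≢ b →
    adj H a b ≡ true → W a ≡ true → W b ≡ true → Matching H W
  addEdge m a b ma mb a≢b e wa wb =
    record { mate = mate′ ; mate-sym = sym′ ; mate-adj = adj′ ; mate-in = in′ }
    where
    mate′ : Fin N → Maybe (Fin N)
    mate′ x with x ≟ a
    ... | yes _ = just b
    ... | no _ with x ≟ b
    ... | yes _ = just a
    ... | no _ = mate m x
    mate′b : mate′ b ≡ just a
    mate′b with b ≟ a
    ... | yes b≡a = ⊥-elim (a≢b (sym b≡a))
    ... | no _ with b ≟ b
    ... | yes _ = refl
    ... | no b≢b = ⊥-elim (b≢b refl)
    mate′a : mate′ a ≡ just b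
    mate′a with a ≟ a
    ... | yes _ = refl
    ... | no a≢a = ⊥-elim (a≢a refl)
    sym′ : ∀ {x y} → mate′ x ≡ just y → mate′ y ≡ just x
    sym′ {x} {y} h with x ≟ a
    ... | yes refl with just-injective h
    ... | refl = mate′b
    sym′ {x} {y} h | no _ with x ≟ b
    ... | yes refl with just-injective h
    ... | refl = mate′a
    sym′ {x} {y} h | no _ | no _ with y ≟ a
    ... | yes refl = ⊥-elim (nothing≢just (trans (sym ma) (mate-sym m h)))
    ... | no _ with y ≟ b
    ... | yes refl = ⊥-elim (nothing≢just (trans (sym mb) (mate-sym m h)))
    ... | no _ = mate-sym m h
    adj′ : ∀ {x y} → mate′ x ≡ just y → adj H x y ≡ true
    adj′ {x} {y} h with x ≟ a
    ... | yes refl with just-injective h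
    ... | refl = e
    adj′ {x} {y} h | no _ with x ≟ b
    ... | yes refl with just-injective h
    ... | refl = trans (adj-sym H _ _) e
    adj′ {x} {y} h | no _ | no _ = mate-adj m h
    in′ : ∀ {x y} → mate′ x ≡ just y → W x ≡ true
    in′ {x} {y} h with x ≟ a
    ... | yes refl = wa
    ... | no _ with x ≟ b
    ... | yes refl = wb
    ... | no _ = mate-in m h

  addEdge-ncovered : (m : Matching H W) (a b : Fin N) (ma : mate m a ≡ nothing) (mb : mate m b ≡ nothing)
    (a≢b : a ≢ b) (e : adj H a b ≡ true) (wa : W a ≡ true) (wb : W b ≡ true) →
    ncovered (addEdge m a b ma mb a≢b e wa wb) ≡ suc (suc (ncovered m))
  addEdge-ncovered m a b ma mb a≢b e wa wb = begin
      ncovered (addEdge m a b ma mb a≢b e wa wb)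
    ≡⟨ count-cong covered′ ⟩
      count (λ x → covered m x ∨ ((x == a) ∨ (x == b)))
    ≡⟨ count-∨ (covered m) _ fresh ⟩
      ncovered m + count (λ x → (x == a) ∨ (x == b))
    ≡⟨ cong (ncovered m +_) (trans (count-∨ _ _ distinct) (cong₂ _+_ (count-singleton a) (count-singleton b))) ⟩
      ncovered m + 2
    ≡⟨ +-comm (ncovered m) 2 ⟩
      suc (suc (ncovered m))
    ∎
    where
    open ≡-Reasoning
    covered′ : ∀ x → covered (addEdge m a b ma mb a≢b e wa wb) x ≡ covered m x ∨ ((x == a) ∨ (x == b))
    covered′ x with x ≟ a
    ... | yes refl rewrite nothing⇒uncovered m ma = refl
    ... | no _ with x ≟ b
    ... | yes refl rewrite nothing⇒uncovered m mb = refl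
    ... | no _ = sym (∨-identityʳ _)
    fresh : ∀ x → covered m x ∧ ((x == a) ∨ (x == b)) ≡ false
    fresh x with x ≟ a
    ... | yes refl rewrite nothing⇒uncovered m ma = refl
    ... | no _ with x ≟ b
    ... | yes refl rewrite nothing⇒uncovered m mb = refl
    ... | no _ = ∧-zeroʳ _
    distinct : ∀ x → (x == a) ∧ (x == b) ≡ false
    distinct x with x ≟ a
    ... | no _ = refl
    ... | yes refl = ==-false a≢b

module _ {N} {H : Graph N} {W : Fin N → Bool} where

  Closed : Matching H W → (Fin N → Bool) → Set
  Closed m Q = ∀ {x y} → Q x ≡ true → mate m x ≡ just y → Q y ≡ true

  Closed-∁ : (m : Matching H W) (Q : Fin N → Bool) → Closed m Q →
    ∀ {x y} → Q x ≡ false → mate m x ≡ just y → Q y ≡ false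
  Closed-∁ m Q closed {x} {y} Qx e with Q y in Qy
  ... | false = refl
  ... | true = ⊥-elim (true≢false (trans (sym (closed Qy (mate-sym m e))) Qx))

  splice : (A B : Matching H W) (Q : Fin N → Bool) → Closed A Q → Closed B Q → Matching H W
  splice A B Q closedA closedB = record { mate = mate′ ; mate-sym = sym′ ; mate-adj = adj′ ; mate-in = in′ }
    where
    mate′ : Fin N → Maybe (Fin N)
    mate′ x = if Q x then mate A x else mate B x
    sym′ : ∀ {x y} → mate′ x ≡ just y → mate′ y ≡ just x
    sym′ {x} {y} h with Q x in Qx
    ... | true rewrite closedA Qx h = mate-sym A h
    ... | false rewrite Closed-∁ B Q closedB Qx h = mate-sym B h
    adj′ : ∀ {x y} → mate′ x ≡ just y → adj H x y ≡ true
    adj′ {x} h with Q x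
    ... | true = mate-adj A h
    ... | false = mate-adj B h
    in′ : ∀ {x y} → mate′ x ≡ just y → W x ≡ true
    in′ {x} h with Q x
    ... | true = mate-in A h
    ... | false = mate-in B h

  splice-covered : ∀ (A B : Matching H W) Q (closedA : Closed A Q) (closedB : Closed B Q) x →
    covered (splice A B Q closedA closedB) x ≡ (if Q x then covered A x else covered B x)
  splice-covered A B Q closedA closedB x with Q x
  ... | true = refl
  ... | false = refl

  splice-ncovered : ∀ (A B : Matching H W) Q (closedA : Closed A Q) (closedB : Closed B Q) →
    ncovered (splice A B Q closedA closedB) + count (λ x → covered B x ∧ Q x)
      ≡ ncovered B + count (λ x → covered A x ∧ Q x)
  splice-ncovered A B Q closedA closedB = begin
      ncovered S + c   ≡⟨ cong (_+ c) (count-partition (covered S) Q _ _ inside outside) ⟩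
      (a + b) + c      ≡⟨ rearrange a b c ⟩
      (c + b) + a      ≡⟨ cong (_+ a) (sym (count-split (covered B) Q)) ⟩
      ncovered B + a   ∎
    where
    open ≡-Reasoning
    rearrange : ∀ a b c → (a + b) + c ≡ (c + b) + a
    rearrange = solve-∀
    S = splice A B Q closedA closedB
    a = count (λ x → covered A x ∧ Q x)
    b = count (λ x → covered B x ∧ not (Q x))
    c = count (λ x → covered B x ∧ Q x)
    inside : ∀ x → covered S x ∧ Q x ≡ covered A x ∧ Q x
    inside x rewrite splice-covered A B Q closedA closedB x with Q x
    ... | true = refl
    ... | false = trans (∧-zeroʳ _) (sym (∧-zeroʳ _))
    outside : ∀ x → covered S x ∧ not (Q x) ≡ covered B x ∧ not (Q x)
    outside x rewrite splice-covered A B Q closedA closedB x with Q x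
    ... | true = trans (∧-zeroʳ _) (sym (∧-zeroʳ _))
    ... | false = refl

  restrict : (m : Matching H W) (R : Fin N → Bool) → Closed m R → Matching H (λ x → W x ∧ R x)
  restrict m R closed = record { mate = mate′ ; mate-sym = sym′ ; mate-adj = adj′ ; mate-in = in′ }
    where
    mate′ : Fin N → Maybe (Fin N)
    mate′ x = if R x then mate m x else nothing
    sym′ : ∀ {x y} → mate′ x ≡ just y → mate′ y ≡ just x
    sym′ {x} h with R x in Rx
    ... | true rewrite closed Rx h = mate-sym m h
    adj′ : ∀ {x y} → mate′ x ≡ just y → adj H x y ≡ true
    adj′ {x} h with R x
    ... | true = mate-adj m h
    in′ : ∀ {x y} → mate′ x ≡ just y → W x ∧ R x ≡ true
    in′ {x} h with R x
    ... | true = trans (∧-identityʳ _) (mate-in m h)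

  restrict-covered : ∀ (m : Matching H W) R (closed : Closed m R) x →
    covered (restrict m R closed) x ≡ covered m x ∧ R x
  restrict-covered m R closed x with R x
  ... | true = sym (∧-identityʳ _)
  ... | false = sym (∧-zeroʳ _)

module _ {N} {H : Graph N} {W : Fin N → Bool} where

  avoiding-closed : (m : Matching H W) {x y : Fin N} → mate m x ≡ just y → Closed m (avoiding x y)
  avoiding-closed m {x} {y} mxy {z} {w} avoid-z mzw with w ≟ x | w ≟ y
  ... | yes refl | _ = ⊥-elim (y≢z (just-injective (trans (sym mxy) (mate-sym m mzw))))
    where
    y≢z : y ≢ z
    y≢z refl with z ≟ x | z ≟ y
    ... | yes z≡x | _ = mate-irrefl m mxy (sym z≡x)
    ... | no _ | yes _ = true≢false (sym avoid-z)
    ... | no _ | no z≢z = z≢z refl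
  ... | no _ | yes refl = ⊥-elim (x≢z (just-injective (trans (sym (mate-sym m mxy)) (mate-sym m mzw))))
    where
    x≢z : x ≢ z
    x≢z refl with z ≟ x
    ... | yes _ = true≢false (sym avoid-z)
    ... | no z≢z = z≢z refl
  ... | no _ | no _ = refl

  removePair : (m : Matching H W) {x y : Fin N} → mate m x ≡ just y → Matching H (λ z → W z ∧ avoiding x y z)
  removePair m mxy = restrict m _ (avoiding-closed m mxy)

  removePair-ncovered : (m : Matching H W) {x y : Fin N} (mxy : mate m x ≡ just y) →
    ncovered m ≡ suc (suc (ncovered (removePair m mxy)))
  removePair-ncovered m {x} {y} mxy =
    trans (count-remove (covered m) x (mate⇒covered m mxy))
      (cong suc (trans (count-remove _ y covered-y) (cong suc (count-cong rest))))
    where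
    covered-y : covered m y ∧ not (y == x) ≡ true
    covered-y rewrite mate-covered m mxy | ==-false {x = y} {x} (λ e → mate-irrefl m mxy (sym e)) = refl
    rest : ∀ z → (covered m z ∧ not (z == x)) ∧ not (z == y) ≡ covered (removePair m mxy) z
    rest z rewrite restrict-covered m _ (avoiding-closed m mxy) z = ∧-assoc (covered m z) _ _

EdgeOf : ∀ {N} → List (Fin N × Fin N) → Fin N → Fin N → Set
EdgeOf M x y = (x , y) Mem.∈ M ⊎ (y , x) Mem.∈ M

module _ {N} {H : Graph N} where

  toIsMatching-fuel : (fuel : ℕ) {W : Fin N → Bool} (m : Matching H W) → ncovered m ≤ fuel →
    (W′ : Subset N) → (∀ {x} → W x ≡ true → lookup W′ x ≡ true) →
    Σ (List (Fin N × Fin N)) λ L → IsMatching H W′ L × 2 * length L ≡ ncovered m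
      × (∀ {x} → x Mem.∈ endpoints L → covered m x ≡ true)
  toIsMatching-fuel zero m ncovered≤0 W′ W⊆W′ = [] , ([] , []) , sym (n≤0⇒n≡0 ncovered≤0) , (λ ())
  toIsMatching-fuel (suc fuel) m ncovered≤fuel W′ W⊆W′ with any? (λ x → covered m x ≟ᵇ true)
  ... | no none = [] , ([] , []) , sym (count-none (covered m) uncovered) , (λ ())
    where
    uncovered : ∀ x → covered m x ≡ false
    uncovered x with covered m x in cx
    ... | true = ⊥-elim (none (x , cx))
    ... | false = refl
  ... | yes (x , cx) with covered⇒mate m cx
  ... | y , mxy =
    (x , y) ∷ L ,
    ((mate-adj m mxy , true⇒∈ (W⊆W′ (mate-in m mxy)) , true⇒∈ (W⊆W′ (mate-in m (mate-sym m mxy)))) ∷ proj₁ L-matching ,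
     All.tabulate x∉L ∷ All.tabulate y∉L ∷ proj₂ L-matching) ,
    size ,
    L-covered
    where
    m′ = removePair m mxy
    m′-ncovered = removePair-ncovered m mxy
    rec = toIsMatching-fuel fuel m′ (≤-trans (n≤1+n _) (pred-mono-≤ (subst (_≤ suc fuel) m′-ncovered ncovered≤fuel)))
            W′ (λ h → W⊆W′ (∧-trueˡ h))
    L = proj₁ rec
    L-matching = proj₁ (proj₂ rec)
    L-covered′ : ∀ {z} → z Mem.∈ endpoints L → covered m′ z ≡ true
    L-covered′ = proj₂ (proj₂ (proj₂ rec))
    L-avoiding : ∀ {z} → z Mem.∈ endpoints L → avoiding x y z ≡ true
    L-avoiding {z} z∈L = ∧-trueʳ {covered m z} (trans (sym (restrict-covered m _ (avoiding-closed m mxy) z)) (L-covered′ z∈L))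
    x∉L : ∀ {z} → z Mem.∈ (y ∷ endpoints L) → x ≢ z
    x∉L (here refl) = mate-irrefl m mxy
    x∉L (there z∈L) refl with L-avoiding z∈L
    ... | avoid rewrite ==-refl x = true≢false (sym avoid)
    y∉L : ∀ {z} → z Mem.∈ endpoints L → y ≢ z
    y∉L z∈L refl with L-avoiding z∈L
    ... | avoid rewrite ==-refl y = true≢false (trans (sym avoid) (∧-zeroʳ _))
    size : 2 * length ((x , y) ∷ L) ≡ ncovered m
    size = begin
        2 * suc (length L)        ≡⟨ *-suc 2 (length L) ⟩
        2 + 2 * length L          ≡⟨ cong (2 +_) (proj₁ (proj₂ (proj₂ rec))) ⟩
        suc (suc (ncovered m′))   ≡⟨ sym m′-ncovered ⟩
        ncovered m                ∎
      where open ≡-Reasoning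
    L-covered : ∀ {z} → z Mem.∈ endpoints ((x , y) ∷ L) → covered m z ≡ true
    L-covered (here refl) = cx
    L-covered (there (here refl)) = mate-covered m mxy
    L-covered {z} (there (there z∈L)) =
      ∧-trueˡ {covered m z} (trans (sym (restrict-covered m _ (avoiding-closed m mxy) z)) (L-covered′ z∈L))

  toIsMatching : {W : Fin N → Bool} (m : Matching H W) → (W′ : Subset N) → (∀ {x} → W x ≡ true → lookup W′ x ≡ true) →
    Σ (List (Fin N × Fin N)) λ L → IsMatching H W′ L × 2 * length L ≡ ncovered m
      × (∀ {x} → x Mem.∈ endpoints L → covered m x ≡ true)
  toIsMatching m = toIsMatching-fuel N m (count≤N _)

module _ {N : ℕ} where
  open import Data.List.Membership.DecPropositional (_≟_ {N}) using (_∈?_)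

  mateIn : Fin N → List (Fin N × Fin N) → Maybe (Fin N)
  mateIn x [] = nothing
  mateIn x ((a , b) ∷ M) with x ≟ a
  ... | yes _ = just b
  ... | no _ with x ≟ b
  ... | yes _ = just a
  ... | no _ = mateIn x M

  mateIn-sound : ∀ {x y} (M : List (Fin N × Fin N)) → mateIn x M ≡ just y → EdgeOf M x y
  mateIn-sound {x} ((a , b) ∷ M) h with x ≟ a
  ... | yes refl with just-injective h
  ... | refl = inj₁ (here refl)
  mateIn-sound {x} ((a , b) ∷ M) h | no _ with x ≟ b
  ... | yes refl with just-injective h
  ... | refl = inj₂ (here refl)
  mateIn-sound {x} ((a , b) ∷ M) h | no _ | no _ with mateIn-sound M h
  ... | inj₁ p = inj₁ (there p)
  ... | inj₂ p = inj₂ (there p)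

  mateIn-endpoint : ∀ {x} (M : List (Fin N × Fin N)) → x Mem.∈ endpoints M → ∃ λ y → mateIn x M ≡ just y
  mateIn-endpoint {x} ((a , b) ∷ M) x∈M with x ≟ a
  ... | yes _ = b , refl
  ... | no x≢a with x ≟ b
  ... | yes _ = a , refl
  ... | no x≢b with x∈M
  ... | here x≡a = ⊥-elim (x≢a x≡a)
  ... | there (here x≡b) = ⊥-elim (x≢b x≡b)
  ... | there (there x∈M′) = mateIn-endpoint M x∈M′

  ∈-endpoints₁ : ∀ {x y} (M : List (Fin N × Fin N)) → (x , y) Mem.∈ M → x Mem.∈ endpoints M
  ∈-endpoints₁ (_ ∷ M) (here refl) = here refl
  ∈-endpoints₁ (_ ∷ M) (there p) = there (there (∈-endpoints₁ M p))

  ∈-endpoints₂ : ∀ {x y} (M : List (Fin N × Fin N)) → (x , y) Mem.∈ M → y Mem.∈ endpoints M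
  ∈-endpoints₂ (_ ∷ M) (here refl) = there (here refl)
  ∈-endpoints₂ (_ ∷ M) (there p) = there (there (∈-endpoints₂ M p))

  EdgeOf⇒∈-endpoints : ∀ {x y} (M : List (Fin N × Fin N)) → EdgeOf M x y → y Mem.∈ endpoints M
  EdgeOf⇒∈-endpoints M (inj₁ p) = ∈-endpoints₂ M p
  EdgeOf⇒∈-endpoints M (inj₂ p) = ∈-endpoints₁ M p

  endpoint-partner : ∀ {w} (M : List (Fin N × Fin N)) → w Mem.∈ endpoints M → ∃ λ w′ → EdgeOf M w w′
  endpoint-partner ((a , b) ∷ M) (here refl) = b , inj₁ (here refl)
  endpoint-partner ((a , b) ∷ M) (there (here refl)) = a , inj₂ (here refl)
  endpoint-partner (_ ∷ M) (there (there p)) with endpoint-partner M p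
  ... | w′ , inj₁ q = w′ , inj₁ (there q)
  ... | w′ , inj₂ q = w′ , inj₂ (there q)

  mateIn-complete : ∀ {x y} (M : List (Fin N × Fin N)) → Unique (endpoints M) → (x , y) Mem.∈ M →
    mateIn x M ≡ just y × mateIn y M ≡ just x
  mateIn-complete ((a , b) ∷ M) (a∉ ∷ b∉ ∷ _) (here refl) = mate-a , mate-b
    where
    mate-a : mateIn a ((a , b) ∷ M) ≡ just b
    mate-a with a ≟ a
    ... | yes _ = refl
    ... | no a≢a = ⊥-elim (a≢a refl)
    mate-b : mateIn b ((a , b) ∷ M) ≡ just a
    mate-b with b ≟ a
    ... | yes b≡a = ⊥-elim (All.lookup a∉ (here refl) (sym b≡a))
    ... | no _ with b ≟ b
    ... | yes _ = refl
    ... | no b≢b = ⊥-elim (b≢b refl)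
  mateIn-complete {x} {y} ((a , b) ∷ M) (a∉ ∷ b∉ ∷ unique) (there p) = mate-x , mate-y
    where
    rec = mateIn-complete M unique p
    mate-x : mateIn x ((a , b) ∷ M) ≡ just y
    mate-x with x ≟ a
    ... | yes refl = ⊥-elim (All.lookup a∉ (there (∈-endpoints₁ M p)) refl)
    ... | no _ with x ≟ b
    ... | yes refl = ⊥-elim (All.lookup b∉ (∈-endpoints₁ M p) refl)
    ... | no _ = proj₁ rec
    mate-y : mateIn y ((a , b) ∷ M) ≡ just x
    mate-y with y ≟ a
    ... | yes refl = ⊥-elim (All.lookup a∉ (there (∈-endpoints₂ M p)) refl)
    ... | no _ with y ≟ b
    ... | yes refl = ⊥-elim (All.lookup b∉ (∈-endpoints₂ M p) refl)
    ... | no _ = proj₂ rec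

  length-endpoints : ∀ (M : List (Fin N × Fin N)) → length (endpoints M) ≡ 2 * length M
  length-endpoints [] = refl
  length-endpoints (e ∷ M) = trans (cong (λ t → suc (suc t)) (length-endpoints M)) (sym (*-suc 2 (length M)))

  covers : List (Fin N × Fin N) → Fin N → Bool
  covers M x = ⌊ x ∈? endpoints M ⌋

  covers⇒∈ : ∀ {M x} → covers M x ≡ true → x Mem.∈ endpoints M
  covers⇒∈ {M = M} {x} h with x ∈? endpoints M
  ... | yes x∈M = x∈M

  ∈⇒covers : ∀ {M x} → x Mem.∈ endpoints M → covers M x ≡ true
  ∈⇒covers {M = M} {x} x∈M with x ∈? endpoints M
  ... | yes _ = refl
  ... | no x∉M = ⊥-elim (x∉M x∈M)

  count-∈-Unique : ∀ (xs : List (Fin N)) → Unique xs → count (λ x → ⌊ x ∈? xs ⌋) ≡ length xs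
  count-∈-Unique [] _ = count-none {N} _ (λ _ → refl)
  count-∈-Unique (a ∷ xs) (a∉ ∷ unique) =
    trans (count-remove _ a a∈) (cong suc (trans (count-cong rest) (count-∈-Unique xs unique)))
    where
    a∈ : ⌊ a ∈? (a ∷ xs) ⌋ ≡ true
    a∈ with a ∈? (a ∷ xs)
    ... | yes _ = refl
    ... | no a∉ = ⊥-elim (a∉ (here refl))
    rest : ∀ x → ⌊ x ∈? (a ∷ xs) ⌋ ∧ not (x == a) ≡ ⌊ x ∈? xs ⌋
    rest x with x ≟ a
    ... | yes refl with x ∈? xs
    ... | yes p = ⊥-elim (All.lookup a∉ p refl)
    ... | no _ = refl
    rest x | no x≢a with x ∈? xs | x ∈? (a ∷ xs)
    ... | yes _ | yes _ = refl
    ... | yes p | no n = ⊥-elim (n (there p))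
    ... | no _ | yes (here p) = ⊥-elim (x≢a p)
    ... | no n | yes (there p) = ⊥-elim (n p)
    ... | no _ | no _ = refl

  count-covers : ∀ M → Unique (endpoints M) → count (covers M) ≡ 2 * length M
  count-covers M unique = trans (count-∈-Unique (endpoints M) unique) (length-endpoints M)

module _ {N} {H : Graph N} where

  fromIsMatching : (W : Subset N) (M : List (Fin N × Fin N)) → IsMatching H W M → Matching H (lookup W)
  fromIsMatching W M (edges , unique) =
    record { mate = λ x → mateIn x M ; mate-sym = sym′ ; mate-adj = adj′ ; mate-in = in′ }
    where
    sym′ : ∀ {x y} → mateIn x M ≡ just y → mateIn y M ≡ just x
    sym′ h with mateIn-sound M h
    ... | inj₁ p = proj₂ (mateIn-complete M unique p)
    ... | inj₂ p = proj₁ (mateIn-complete M unique p)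
    adj′ : ∀ {x y} → mateIn x M ≡ just y → adj H x y ≡ true
    adj′ h with mateIn-sound M h
    ... | inj₁ p = proj₁ (All.lookup edges p)
    ... | inj₂ p = trans (adj-sym H _ _) (proj₁ (All.lookup edges p))
    in′ : ∀ {x y} → mateIn x M ≡ just y → lookup W x ≡ true
    in′ h with mateIn-sound M h
    ... | inj₁ p = ∈⇒true (proj₁ (proj₂ (All.lookup edges p)))
    ... | inj₂ p = ∈⇒true (proj₂ (proj₂ (All.lookup edges p)))

  fromIsMatching-covered : ∀ W M (isM : IsMatching H W M) x → covered (fromIsMatching W M isM) x ≡ covers M x
  fromIsMatching-covered W M isM x with mateIn x M in mx | covers M x in cx
  ... | just y | true = refl
  ... | just y | false with mateIn-sound M mx
  ... | inj₁ p = ⊥-elim (true≢false (trans (sym (∈⇒covers {M = M} (∈-endpoints₁ M p))) cx))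
  ... | inj₂ p = ⊥-elim (true≢false (trans (sym (∈⇒covers {M = M} (∈-endpoints₂ M p))) cx))
  fromIsMatching-covered W M isM x | nothing | true with mateIn-endpoint M (covers⇒∈ {M = M} cx)
  ... | y , e = ⊥-elim (nothing≢just (trans (sym mx) e))
  fromIsMatching-covered W M isM x | nothing | false = refl

  fromIsMatching-ncovered : ∀ W M (isM : IsMatching H W M) → ncovered (fromIsMatching W M isM) ≡ 2 * length M
  fromIsMatching-ncovered W M isM =
    trans (count-cong (fromIsMatching-covered W M isM)) (count-covers M (proj₂ isM))

  extends-mate : ∀ {W} (M M′ : List (Fin N × Fin N)) (isM′ : IsMatching H W M′) → Extends M M′ →
    ∀ {x y} → EdgeOf M x y → mate (fromIsMatching W M′ isM′) x ≡ just y
  extends-mate M M′ isM′ ext (inj₁ q) with All.lookup ext q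
  ... | inj₁ r = proj₁ (mateIn-complete M′ (proj₂ isM′) r)
  ... | inj₂ r = proj₂ (mateIn-complete M′ (proj₂ isM′) r)
  extends-mate M M′ isM′ ext (inj₂ q) with All.lookup ext q
  ... | inj₁ r = proj₂ (mateIn-complete M′ (proj₂ isM′) r)
  ... | inj₂ r = proj₁ (mateIn-complete M′ (proj₂ isM′) r)

  extends-closed : ∀ {W} M M′ (isM′ : IsMatching H W M′) → Extends M M′ →
    Closed (fromIsMatching W M′ isM′) (covers M)
  extends-closed M M′ isM′ ext {x} {y} x∈M mxy with endpoint-partner M (covers⇒∈ {M = M} x∈M)
  ... | x′ , edge with just-injective (trans (sym (extends-mate M M′ isM′ ext edge)) mxy)
  ... | refl = ∈⇒covers {M = M} (EdgeOf⇒∈-endpoints M edge)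

  off-M-closed : ∀ {W} M M′ (isM′ : IsMatching H W M′) → Extends M M′ →
    Closed (fromIsMatching W M′ isM′) (λ z → not (covers M z))
  off-M-closed M M′ isM′ ext off mzw =
    cong not (Closed-∁ (fromIsMatching _ M′ isM′) (covers M) (extends-closed M M′ isM′ ext) (not-true off) mzw)

  beyond : ∀ {W} M M′ (isM′ : IsMatching H W M′) → Extends M M′ → Matching H (λ z → lookup W z ∧ not (covers M z))
  beyond M M′ isM′ ext = restrict (fromIsMatching _ M′ isM′) _ (off-M-closed M M′ isM′ ext)

  beyond-ncovered : ∀ {W} M M′ (isM′ : IsMatching H W M′) (ext : Extends M M′) →
    2 * length M′ ≡ count (covers M) + ncovered (beyond M M′ isM′ ext)
  beyond-ncovered {W} M M′ isM′ ext = trans (sym (fromIsMatching-ncovered W M′ isM′))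
    (count-partition (covered m′) (covers M) (covers M) _ on-M (λ z → sym (restrict-covered m′ _ (off-M-closed M M′ isM′ ext) z)))
    where
    m′ = fromIsMatching W M′ isM′
    on-M : ∀ z → covered m′ z ∧ covers M z ≡ covers M z
    on-M z with covers M z in c
    ... | true = trans (∧-identityʳ _) (mate⇒covered m′ (extends-mate M M′ isM′ ext
                   (proj₂ (endpoint-partner M (covers⇒∈ {M = M} c)))))
    ... | false = ∧-zeroʳ _

endpoint-in : ∀ {N} {H : Graph N} {W : Subset N} {M} → IsMatching H W M → ∀ {w} → w Mem.∈ endpoints M → w ∈ W
endpoint-in {M = M} isM w∈M with endpoint-partner M w∈M
... | _ , inj₁ q = proj₁ (proj₂ (All.lookup (proj₁ isM) q))
... | _ , inj₂ q = proj₂ (proj₂ (All.lookup (proj₁ isM) q))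

IsMatching-transfer : ∀ {N} {H H′ : Graph N} {W W′ : Subset N} {M} → IsMatching H W M →
  (∀ {x y} → (x , y) Mem.∈ M → adj H′ x y ≡ true) → (∀ {x} → x Mem.∈ endpoints M → x ∈ W′) →
  IsMatching H′ W′ M
IsMatching-transfer {M = M} (_ , unique) edge′ in′ =
  All.tabulate (λ {(x , y)} p → edge′ p , in′ (∈-endpoints₁ M p) , in′ (∈-endpoints₂ M p)) , unique

-- Alternating paths

not-≢ : ∀ b → not b ≢ b
not-≢ true ()
not-≢ false ()

≢⇒≡not : ∀ {b c} → b ≢ c → b ≡ not c
≢⇒≡not {true} {true} b≢c = ⊥-elim (b≢c refl)
≢⇒≡not {true} {false} _ = refl
≢⇒≡not {false} {true} _ = refl
≢⇒≡not {false} {false} b≢c = ⊥-elim (b≢c refl)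

-- The component of x in A ∪ B when B misses x: a path that starts with an A-edge and alternates.
data PathShape {N} {H : Graph N} {W : Fin N → Bool} (A B : Matching H W) (x z : Fin N) : Set where
  trivial : x ≡ z → covered A x ≡ false → PathShape A B x z
  even : x ≢ z → covered A x ≡ true → covered A z ≡ false → covered B z ≡ true → PathShape A B x z
  augmenting : x ≢ z → covered A x ≡ true → covered B z ≡ false → covered A z ≡ true → PathShape A B x z

record AlternatingPath {N} {H : Graph N} {W : Fin N → Bool} (A B : Matching H W) (x : Fin N) : Set where
  field
    onPath : Fin N → Bool
    end : Fin N
    start-on : onPath x ≡ true
    end-on : onPath end ≡ true
    closedA : Closed A onPath
    closedB : Closed B onPath
    interior : ∀ {y} → onPath y ≡ true → y ≢ x → y ≢ end → covered A y ≡ true × covered B y ≡ true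
    shape : PathShape A B x end
    least : ∀ (P : Fin N → Bool) → P x ≡ true → Closed A P → Closed B P → ∀ {y} → onPath y ≡ true → P y ≡ true

module AlternatingWalk {N} {H : Graph N} {W : Fin N → Bool} (A B : Matching H W) (x : Fin N)
  (x∉B : mate B x ≡ nothing) where

  mateBy : Bool → Fin N → Maybe (Fin N)
  mateBy true = mate A
  mateBy false = mate B

  usesA : ℕ → Bool
  usesA zero = true
  usesA (suc i) = not (usesA i)

  walk : ℕ → Maybe (Fin N)
  walk zero = just x
  walk (suc i) = walk i Data.Maybe.>>= mateBy (usesA i)

  walk-suc : ∀ {i p} → walk i ≡ just p → walk (suc i) ≡ mateBy (usesA i) p
  walk-suc e rewrite e = refl

  walk-pred : ∀ {i q} → walk (suc i) ≡ just q → ∃ λ p → walk i ≡ just p × mateBy (usesA i) p ≡ just q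
  walk-pred {i} e with walk i
  ... | just p = p , refl , e

  walk-down : ∀ {i j q} → i ≤ j → walk j ≡ just q → ∃ λ p → walk i ≡ just p
  walk-down {i} {j} i≤j wj with m≤n⇒m<n∨m≡n i≤j
  ... | inj₂ refl = _ , wj
  walk-down {i} {suc j} i≤j wj | inj₁ i<j with walk-pred {j} wj
  ... | p , wjp , _ = walk-down (s≤s⁻¹ i<j) wjp

  mateBy-sym : ∀ t {p q} → mateBy t p ≡ just q → mateBy t q ≡ just p
  mateBy-sym true = mate-sym A
  mateBy-sym false = mate-sym B

  mateBy-irrefl : ∀ t {p q} → mateBy t p ≡ just q → p ≢ q
  mateBy-irrefl true = mate-irrefl A
  mateBy-irrefl false = mate-irrefl B

  mateBy-covered : ∀ t {y q r} → mateBy t y ≡ just q → mateBy (not t) y ≡ just r →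
    covered A y ≡ true × covered B y ≡ true
  mateBy-covered true e e′ = mate⇒covered A e , mate⇒covered B e′
  mateBy-covered false e e′ = mate⇒covered A e′ , mate⇒covered B e

  -- A repeated vertex would need a third matching edge at it, or an A-edge at x (which B misses).
  walk-injective : (fuel : ℕ) → ∀ j → j < fuel → ∀ i → i < j → ∀ {p} → walk i ≡ just p → walk j ≡ just p → ⊥
  walk-injective (suc fuel) (suc j) (s≤s j<fuel) i i<j {p} wi wj with walk-pred {j} wj
  ... | q , wjq , mq with mateBy-sym (usesA j) mq
  ... | mp with i
  ... | zero with just-injective wi
  ... | refl with usesA j in usesA-j
  ... | false = nothing≢just (trans (sym x∉B) mp)
  ... | true with j
  ... | zero = mateBy-irrefl true mp (just-injective wjq)
  ... | suc zero = not-≢ true usesA-j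
  ... | suc (suc j′) =
    walk-injective fuel (suc (suc j′)) j<fuel 1 (s≤s (s≤s z≤n)) (trans (walk-suc {0} refl) mp) wjq
  walk-injective (suc fuel) (suc j) (s≤s j<fuel) i i<j {p} wi wj | q , wjq , mq | mp | suc i′
    with walk-pred {i′} wi
  ... | r , wi′r , mr with mateBy-sym (usesA i′) mr | usesA j ≟ᵇ usesA i′
  ... | mpr | yes same =
    walk-injective fuel j j<fuel i′ (s≤s⁻¹ i<j)
      (trans wi′r (cong just (just-injective (trans (sym mpr) (trans (cong (λ t → mateBy t p) (sym same)) mp))))) wjq
  ... | mpr | no differ with m≤n⇒m<n∨m≡n (s≤s⁻¹ i<j)
  ... | inj₂ refl = mateBy-irrefl (usesA (suc i′)) mp′ (just-injective (trans (sym wi) wjq))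
    where
    mp′ : mateBy (usesA (suc i′)) p ≡ just q
    mp′ = trans (cong (λ t → mateBy t p) (sym (≢⇒≡not differ))) mp
  ... | inj₁ si′<j with m≤n⇒m<n∨m≡n si′<j
  ... | inj₂ refl = not-≢ (not (usesA i′)) (≢⇒≡not differ)
  ... | inj₁ ssi′<j = walk-injective fuel j j<fuel (suc (suc i′)) ssi′<j w₂ wjq
    where
    w₂ : walk (suc (suc i′)) ≡ just q
    w₂ = trans (walk-suc {suc i′} wi) (trans (cong (λ t → mateBy t p) (sym (≢⇒≡not differ))) mp)

  walk-stops-after : ∀ i → walk i ≡ nothing → ∃ λ L → ∃ λ z → walk L ≡ just z × walk (suc L) ≡ nothing
  walk-stops-after (suc i) e with walk i in wi
  ... | just z = i , z , wi , trans (walk-suc {i} wi) e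
  ... | nothing = walk-stops-after i wi

  -- By pigeonhole, the first N + 1 steps cannot all be defined.
  walk-stops : ∃ λ L → ∃ λ z → walk L ≡ just z × walk (suc L) ≡ nothing
  walk-stops with any? (λ (i : Fin (suc N)) → is-just (walk (toℕ i)) ≟ᵇ false)
  ... | yes (i , undefined) = walk-stops-after (toℕ i) (is-just≡false undefined)
    where
    is-just≡false : ∀ {m : Maybe (Fin N)} → is-just m ≡ false → m ≡ nothing
    is-just≡false {nothing} _ = refl
  ... | no none =
    ⊥-elim (walk-injective (suc (toℕ j)) (toℕ j) ≤-refl (toℕ i) i<j
              (defined-eq i) (trans (defined-eq j) (cong just (sym same))))
    where
    defined : ∀ (i : Fin (suc N)) → is-just (walk (toℕ i)) ≡ true
    defined i with is-just (walk (toℕ i)) in d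
    ... | true = refl
    ... | false = ⊥-elim (none (i , d))
    vertex : Fin (suc N) → Fin N
    vertex i with walk (toℕ i) | defined i
    ... | just p | _ = p
    defined-eq : ∀ i → walk (toℕ i) ≡ just (vertex i)
    defined-eq i with walk (toℕ i) | defined i
    ... | just p | _ = refl
    collision = pigeonhole ≤-refl vertex
    i = proj₁ collision
    j = proj₁ (proj₂ collision)
    i<j = proj₁ (proj₂ (proj₂ collision))
    same = proj₂ (proj₂ (proj₂ collision))

  is : Maybe (Fin N) → Fin N → Bool
  is nothing y = false
  is (just p) y = p == y

  is-sound : ∀ m {y} → is m y ≡ true → m ≡ just y
  is-sound (just p) e = cong just (==-true e)

  is-complete : ∀ {m y} → m ≡ just y → is m y ≡ true
  is-complete {y = y} refl = ==-refl y

  visited : ℕ → Fin N → Bool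
  visited zero y = is (walk 0) y
  visited (suc i) y = is (walk (suc i)) y ∨ visited i y

  visited-sound : ∀ L {y} → visited L y ≡ true → ∃ λ i → i ≤ L × walk i ≡ just y
  visited-sound zero v = 0 , z≤n , is-sound (walk 0) v
  visited-sound (suc L) {y} v with is (walk (suc L)) y in now
  ... | true = suc L , ≤-refl , is-sound (walk (suc L)) now
  ... | false with visited-sound L v
  ... | i , i≤L , wi = i , m≤n⇒m≤1+n i≤L , wi

  visited-complete : ∀ L {i y} → i ≤ L → walk i ≡ just y → visited L y ≡ true
  visited-complete zero {zero} z≤n wi = is-complete wi
  visited-complete (suc L) {i} {y} i≤L wi with m≤n⇒m<n∨m≡n i≤L
  ... | inj₂ refl rewrite is-complete wi = refl
  ... | inj₁ i<L = trans (cong (is (walk (suc L)) y ∨_) (visited-complete L (s≤s⁻¹ i<L) wi)) (∨-zeroʳ _)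

  shape-at : ∀ L z → walk L ≡ just z → walk (suc L) ≡ nothing → PathShape A B x z
  shape-at zero z wL stop with just-injective wL
  ... | refl = trivial refl (nothing⇒uncovered A stop)
  shape-at (suc L) z wL stop with walk-down {1} {suc L} (s≤s z≤n) wL
  ... | _ , w1 with walk-pred {L} wL
  ... | r , _ , mr = last (usesA L) (mateBy-sym (usesA L) mr) (trans (sym (walk-suc {suc L} wL)) stop)
    where
    x≢z : x ≢ z
    x≢z x≡z = walk-injective (suc (suc L)) (suc L) ≤-refl 0 (s≤s z≤n) (cong just x≡z) wL
    last : ∀ t → mateBy t z ≡ just r → mateBy (not t) z ≡ nothing → PathShape A B x z
    last true viaA stop′ = augmenting x≢z (mate⇒covered A w1) (nothing⇒uncovered B stop′) (mate⇒covered A viaA)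
    last false viaB stop′ = even x≢z (mate⇒covered A w1) (nothing⇒uncovered A stop′) (mate⇒covered B viaB)

  module _ (L : ℕ) (z : Fin N) (wL : walk L ≡ just z) (stop : walk (suc L) ≡ nothing) where

    visited-closed : ∀ t {y y′} → visited L y ≡ true → mateBy t y ≡ just y′ → visited L y′ ≡ true
    visited-closed t {y} {y′} vy my with visited-sound L vy
    ... | i , i≤L , wi with t ≟ᵇ usesA i
    ... | yes refl with m≤n⇒m<n∨m≡n i≤L
    ... | inj₂ refl = ⊥-elim (nothing≢just (trans (sym stop) (trans (walk-suc {i} wi) my)))
    ... | inj₁ i<L = visited-complete L i<L (trans (walk-suc {i} wi) my)
    visited-closed t {y} {y′} vy my | zero , i≤L , wi | no differ with just-injective wi
    ... | refl = ⊥-elim (nothing≢just (trans (sym x∉B) (trans (cong (λ t → mateBy t x) (sym (≢⇒≡not differ))) my)))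
    visited-closed t {y} {y′} vy my | suc i , i≤L , wi | no differ with walk-pred {i} wi
    ... | r , wir , mr = visited-complete L (≤-trans (n≤1+n i) i≤L)
           (trans wir (cong just (just-injective (trans (sym (mateBy-sym (usesA i) mr))
             (trans (cong (λ t → mateBy t y) (trans (sym (not-involutive (usesA i))) (sym (≢⇒≡not differ)))) my)))))

    visited-interior : ∀ {y} → visited L y ≡ true → y ≢ x → y ≢ z → covered A y ≡ true × covered B y ≡ true
    visited-interior {y} vy y≢x y≢z with visited-sound L vy
    ... | zero , _ , wi = ⊥-elim (y≢x (sym (just-injective wi)))
    ... | suc i , i≤L , wi with m≤n⇒m<n∨m≡n i≤L
    ... | inj₂ refl = ⊥-elim (y≢z (just-injective (trans (sym wi) wL)))
    ... | inj₁ i<L with walk-pred {i} wi | walk-down i<L wL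
    ... | _ , _ , mr | _ , wsi =
      mateBy-covered (usesA i) (mateBy-sym (usesA i) mr) (trans (sym (walk-suc {suc i} wi)) wsi)

    visited-least : ∀ (P : Fin N → Bool) → P x ≡ true → Closed A P → Closed B P →
      ∀ {y} → visited L y ≡ true → P y ≡ true
    visited-least P Px closedA closedB vy with visited-sound L vy
    ... | i , _ , wi = along i wi
      where
      along : ∀ i {y} → walk i ≡ just y → P y ≡ true
      along zero refl = Px
      along (suc i) wi with walk-pred {i} wi
      ... | p , wip , mp with usesA i
      ... | true = closedA (along i wip) mp
      ... | false = closedB (along i wip) mp

  alternatingPath : AlternatingPath A B x
  alternatingPath with walk-stops
  ... | L , z , wL , stop = record
    { onPath = visited L ; end = z
    ; start-on = visited-complete L z≤n refl ; end-on = visited-complete L ≤-refl wL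
    ; closedA = visited-closed L z wL stop true ; closedB = visited-closed L z wL stop false
    ; interior = visited-interior L z wL stop ; shape = shape-at L z wL stop
    ; least = visited-least L z wL stop }

module _ {N} {H : Graph N} {W : Fin N → Bool} {A B : Matching H W} {x : Fin N}
  (x∉B : mate B x ≡ nothing) (P : AlternatingPath A B x) where
  open AlternatingPath P

  private
    onPath-covered : ∀ (m : Matching H W) → (∀ {t} → onPath t ≡ true → t ≢ x → t ≢ end → covered m t ≡ true) →
      ∀ t → (t ≡ x → covered m t ≡ true) → (t ≡ end → covered m t ≡ true) → covered m t ∧ onPath t ≡ onPath t
    onPath-covered m inside t at-x at-end with onPath t in on
    ... | false = ∧-zeroʳ _
    ... | true with t ≟ x | t ≟ end
    ... | yes t≡x | _ = trans (∧-identityʳ _) (at-x t≡x)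
    ... | no _ | yes t≡end = trans (∧-identityʳ _) (at-end t≡end)
    ... | no t≢x | no t≢end = trans (∧-identityʳ _) (inside on t≢x t≢end)

    drop-uncovered : ∀ (m : Matching H W) v → covered m v ≡ false →
      ∀ t → (t ≢ v → covered m t ∧ onPath t ≡ onPath t) → onPath t ∧ not (t == v) ≡ covered m t ∧ onPath t
    drop-uncovered m v uncovered t covered-elsewhere with t ≟ v
    ... | yes refl rewrite uncovered = ∧-zeroʳ _
    ... | no t≢v = trans (∧-identityʳ _) (sym (covered-elsewhere t≢v))

  A-interior : ∀ {t} → onPath t ≡ true → t ≢ x → t ≢ end → covered A t ≡ true
  A-interior on t≢x t≢end = proj₁ (interior on t≢x t≢end)

  B-interior : ∀ {t} → onPath t ≡ true → t ≢ x → t ≢ end → covered B t ≡ true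
  B-interior on t≢x t≢end = proj₂ (interior on t≢x t≢end)

  even-path-balanced : x ≢ end → covered A x ≡ true → covered A end ≡ false → covered B end ≡ true →
    count (λ t → covered A t ∧ onPath t) ≡ count (λ t → covered B t ∧ onPath t)
  even-path-balanced x≢end Ax A-end B-end = suc-injective (begin
      suc (count (λ t → covered A t ∧ onPath t))
    ≡⟨ cong suc (count-cong (λ t → sym (drop-uncovered A end A-end t (λ t≢end →
          onPath-covered A A-interior t (λ { refl → Ax }) (λ t≡end → ⊥-elim (t≢end t≡end)))))) ⟩
      suc (count (λ t → onPath t ∧ not (t == end)))
    ≡⟨ sym (count-remove onPath end end-on) ⟩
      count onPath
    ≡⟨ count-remove onPath x start-on ⟩
      suc (count (λ t → onPath t ∧ not (t == x)))
    ≡⟨ cong suc (count-cong (λ t → drop-uncovered B x (nothing⇒uncovered B x∉B) t (λ t≢x →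
          onPath-covered B B-interior t (λ t≡x → ⊥-elim (t≢x t≡x)) (λ { refl → B-end })))) ⟩
      suc (count (λ t → covered B t ∧ onPath t))
    ∎)
    where open ≡-Reasoning

  augmenting-path-gain : x ≢ end → covered A x ≡ true → covered B end ≡ false → covered A end ≡ true →
    count (λ t → covered A t ∧ onPath t) ≡ suc (suc (count (λ t → covered B t ∧ onPath t)))
  augmenting-path-gain x≢end Ax B-end A-end = begin
      count (λ t → covered A t ∧ onPath t)
    ≡⟨ count-cong (λ t → onPath-covered A A-interior t (λ { refl → Ax }) (λ { refl → A-end })) ⟩
      count onPath
    ≡⟨ count-remove onPath x start-on ⟩
      suc (count (λ t → onPath t ∧ not (t == x)))
    ≡⟨ cong suc (count-remove _ end end-on′) ⟩
      suc (suc (count (λ t → (onPath t ∧ not (t == x)) ∧ not (t == end))))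
    ≡⟨ cong (λ n → suc (suc n)) (count-cong rest) ⟩
      suc (suc (count (λ t → covered B t ∧ onPath t)))
    ∎
    where
    open ≡-Reasoning
    end-on′ : onPath end ∧ not (end == x) ≡ true
    end-on′ rewrite end-on | ==-false {x = end} {x} (λ e → x≢end (sym e)) = refl
    rest : ∀ t → (onPath t ∧ not (t == x)) ∧ not (t == end) ≡ covered B t ∧ onPath t
    rest t with t ≟ end
    ... | yes refl rewrite B-end = ∧-zeroʳ _
    ... | no t≢end = trans (∧-identityʳ _) (drop-uncovered B x (nothing⇒uncovered B x∉B) t (λ t≢x →
          onPath-covered B B-interior t (λ t≡x → ⊥-elim (t≢x t≡x)) (λ t≡end → ⊥-elim (t≢end t≡end))))

-- Gallai's lemma

module Gallai {N} (G : Graph N) (W : Subset N) (c : ℕ)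
  (no-larger : (m : Matching G (lookup W)) → ncovered m ≡ suc (suc c) → ⊥)
  (each-missed : ∀ w → lookup W w ≡ true → Σ (Matching G (lookup W)) λ m → ncovered m ≡ c × covered m w ≡ false)
  where

  no-augmenting-edge : (m : Matching G (lookup W)) → ncovered m ≡ c → ∀ {a b} → covered m a ≡ false → covered m b ≡ false →
    adj G a b ≡ true → lookup W a ≡ true → lookup W b ≡ true → ⊥
  no-augmenting-edge m size {a} {b} ma mb e Wa Wb =
    no-larger (addEdge m a b ma′ mb′ (adj-irrefl G e) e Wa Wb)
      (trans (addEdge-ncovered m a b ma′ mb′ (adj-irrefl G e) e Wa Wb) (cong (λ n → suc (suc n)) size))
    where
    ma′ = uncovered⇒nothing m ma
    mb′ = uncovered⇒nothing m mb

  no-augmenting-path : (A B : Matching G (lookup W)) → ncovered B ≡ c → ∀ {x} (x∉B : mate B x ≡ nothing)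
    (P : AlternatingPath A B x) → let open AlternatingPath P in
    x ≢ end → covered A x ≡ true → covered B end ≡ false → covered A end ≡ true → ⊥
  no-augmenting-path A B size x∉B P x≢end Ax B-end A-end =
    no-larger (splice A B onPath closedA closedB) (+-cancelʳ-≡ _ _ _ (begin
        ncovered (splice A B onPath closedA closedB) + count (λ t → covered B t ∧ onPath t)
      ≡⟨ splice-ncovered A B onPath closedA closedB ⟩
        ncovered B + count (λ t → covered A t ∧ onPath t)
      ≡⟨ cong₂ _+_ size (augmenting-path-gain x∉B P x≢end Ax B-end A-end) ⟩
        c + suc (suc (count (λ t → covered B t ∧ onPath t)))
      ≡⟨ +-suc c _ ⟩
        suc (c + suc (count (λ t → covered B t ∧ onPath t)))
      ≡⟨ cong suc (+-suc c _) ⟩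
        suc (suc c) + count (λ t → covered B t ∧ onPath t)
      ∎))
    where
    open AlternatingPath P
    open ≡-Reasoning

  even-swap : (A B : Matching G (lookup W)) → ∀ {x} (x∉B : mate B x ≡ nothing) (P : AlternatingPath A B x) →
    let open AlternatingPath P in
    x ≢ end → covered A x ≡ true → covered A end ≡ false → covered B end ≡ true →
    ncovered (splice B A onPath closedB closedA) ≡ ncovered A
  even-swap A B x∉B P x≢end Ax A-end B-end = +-cancelʳ-≡ _ _ _ (begin
      ncovered (splice B A onPath closedB closedA) + count (λ t → covered A t ∧ onPath t)
    ≡⟨ splice-ncovered B A onPath closedB closedA ⟩
      ncovered A + count (λ t → covered B t ∧ onPath t)
    ≡⟨ cong (ncovered A +_) (sym (even-path-balanced x∉B P x≢end Ax A-end B-end)) ⟩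
      ncovered A + count (λ t → covered A t ∧ onPath t)
    ∎)
    where
    open AlternatingPath P
    open ≡-Reasoning

  disagree : Matching G (lookup W) → Matching G (lookup W) → Fin N → Bool
  disagree m m′ t = not ⌊ ≡-decᵐ _≟_ (mate m′ t) (mate m t) ⌋

  -- The only m-missed vertex of an even alternating path from y is its end.
  one-missed-off-path : (m n : Matching G (lookup W)) → ∀ {y} (y∉n : mate n y ≡ nothing) (P : AlternatingPath m n y) →
    let open AlternatingPath P in
    covered m y ≡ true → ∀ {a b} → a ≢ b → covered m a ≡ false → covered m b ≡ false →
    covered n a ≡ true → covered n b ≡ true →
    ∃ λ a′ → onPath a′ ≡ false × covered m a′ ≡ false × covered n a′ ≡ true
  one-missed-off-path m n {y} y∉n P my {a} {b} a≢b ma mb na nb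
    with AlternatingPath.onPath P a in Pa | AlternatingPath.onPath P b in Pb
  ... | false | _ = a , Pa , ma , na
  ... | true | false = b , Pb , mb , nb
  ... | true | true = ⊥-elim (a≢b (trans (is-end Pa ma) (sym (is-end Pb mb))))
    where
    open AlternatingPath P
    is-end : ∀ {t} → onPath t ≡ true → covered m t ≡ false → t ≡ end
    is-end {t} on mt with t ≟ end
    ... | yes t≡end = t≡end
    ... | no t≢end with t ≟ y
    ... | yes refl = ⊥-elim (true≢false (trans (sym my) mt))
    ... | no t≢y = ⊥-elim (true≢false (trans (sym (A-interior y∉n P on t≢y t≢end)) mt))

  -- Swapping n to m along the alternating path from a′ moves n closer to m; a set closed under both
  -- matchings that contains y but not a′ keeps that path, and hence the swap, away from y.
  move-towards : (m n : Matching G (lookup W)) → ncovered m ≡ c → ncovered n ≡ c → ∀ {a′ y} →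
    covered m a′ ≡ false → covered n a′ ≡ true → covered n y ≡ false →
    (Q : Fin N → Bool) → Closed m Q → Closed n Q → Q y ≡ true → Q a′ ≡ false →
    Σ (Matching G (lookup W)) λ n′ → ncovered n′ ≡ c × covered n′ y ≡ false × count (disagree m n′) < count (disagree m n)
  move-towards m n m-size n-size {a′} {y} ma′ na′ ny Q closed-m closed-n Qy Qa′ = along-R (AlternatingPath.shape R)
    where
    a′∉m = uncovered⇒nothing m ma′
    R = AlternatingWalk.alternatingPath n m a′ a′∉m
    module R = AlternatingPath R
    along-R : PathShape n m a′ R.end →
      Σ (Matching G (lookup W)) λ n′ → ncovered n′ ≡ c × covered n′ y ≡ false × count (disagree m n′) < count (disagree m n)
    along-R (trivial _ na′′) = ⊥-elim (true≢false (trans (sym na′) na′′))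
    along-R (augmenting a′≢end na′′ m-end n-end) = ⊥-elim (no-augmenting-path n m m-size a′∉m R a′≢end na′′ m-end n-end)
    along-R (even a′≢end na′′ n-end m-end) = n′ , n′-size , n′y , fewer
      where
      n′ = splice m n R.onPath R.closedB R.closedA
      n′-size : ncovered n′ ≡ c
      n′-size = trans (even-swap n m a′∉m R a′≢end na′′ n-end m-end) n-size
      y∉R : R.onPath y ≡ false
      y∉R with R.onPath y in Ry
      ... | false = refl
      ... | true = ⊥-elim (true≢false (trans (sym Qy) (trans (sym (not-involutive (Q y)))
              (cong not (R.least (λ t → not (Q t)) (cong not Qa′)
                (λ h e → cong not (Closed-∁ n Q closed-n (not-true h) e))
                (λ h e → cong not (Closed-∁ m Q closed-m (not-true h) e))
                Ry)))))
      n′y : covered n′ y ≡ false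
      n′y = trans (splice-covered m n R.onPath R.closedB R.closedA y)
              (trans (cong (λ t → if t then covered m y else covered n y) y∉R) ny)
      disagree-n′ : ∀ t → disagree m n′ t ≡ (if R.onPath t then false else disagree m n t)
      disagree-n′ t with R.onPath t
      ... | true with ≡-decᵐ _≟_ (mate m t) (mate m t)
      ... | yes _ = refl
      ... | no differ = ⊥-elim (differ refl)
      disagree-n′ t | false = refl
      shrinks : ∀ t → disagree m n′ t ≡ true → disagree m n t ≡ true
      shrinks t h rewrite disagree-n′ t with R.onPath t
      ... | false = h
      agrees-a′ : disagree m n′ a′ ≡ false
      agrees-a′ rewrite disagree-n′ a′ | R.start-on = refl
      disagrees-a′ : disagree m n a′ ≡ true
      disagrees-a′ = differ (proj₂ (covered⇒mate n na′)) a′∉m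
        where
        differ : ∀ {p q : Maybe (Fin N)} {r} → p ≡ just r → q ≡ nothing → not ⌊ ≡-decᵐ _≟_ p q ⌋ ≡ true
        differ refl refl = refl
      fewer : count (disagree m n′) < count (disagree m n)
      fewer = count-mono-< (disagree m n′) (disagree m n) shrinks a′ agrees-a′ disagrees-a′

  -- Along a walk a y ... b: a maximum matching n missing y is moved towards m until it misses a or b as well.
  missed-unique : ∀ {a b} → Reach G W a b → (m : Matching G (lookup W)) → ncovered m ≡ c → lookup W a ≡ true → a ≢ b →
    covered m a ≡ false → covered m b ≡ false → ⊥
  missed-unique here m size Wa a≢b ma mb = a≢b refl
  missed-unique (step {a} {y} {b} e y∈W walk) m size Wa a≢b ma mb with y ≟ b | covered m y in my
  ... | yes refl | _ = no-augmenting-edge m size ma mb e Wa (∈⇒true y∈W)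
  ... | no _ | false = no-augmenting-edge m size ma my e Wa (∈⇒true y∈W)
  ... | no y≢b | true = start (each-missed y (∈⇒true y∈W))
    where
    reduce : (fuel : ℕ) → (n : Matching G (lookup W)) → count (disagree m n) < fuel → ncovered n ≡ c → covered n y ≡ false → ⊥
    reduce (suc fuel) n bound n-size ny with covered n a in na | covered n b in nb
    ... | false | _ = no-augmenting-edge n n-size na ny e Wa (∈⇒true y∈W)
    ... | true | false = missed-unique walk n n-size (∈⇒true y∈W) y≢b ny nb
    ... | true | true = along-P (AlternatingPath.shape P)
      where
      y∉n = uncovered⇒nothing n ny
      P = AlternatingWalk.alternatingPath m n y y∉n
      open AlternatingPath P using (onPath; end; closedA; closedB; start-on)
      continue : (Σ (Matching G (lookup W)) λ n′ → ncovered n′ ≡ c × covered n′ y ≡ false ×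
        count (disagree m n′) < count (disagree m n)) → ⊥
      continue (n′ , n′-size , n′y , fewer) = reduce fuel n′ (≤-trans fewer (s≤s⁻¹ bound)) n′-size n′y
      off-P : (∃ λ a′ → onPath a′ ≡ false × covered m a′ ≡ false × covered n a′ ≡ true) → ⊥
      off-P (a′ , off , ma′ , na′) = continue (move-towards m n size n-size ma′ na′ ny onPath closedA closedB start-on off)
      along-P : PathShape m n y end → ⊥
      along-P (trivial _ my′) = true≢false (trans (sym my) my′)
      along-P (augmenting y≢end my′ n-end m-end) = no-augmenting-path m n n-size y∉n P y≢end my′ n-end m-end
      along-P (even _ _ _ _) = off-P (one-missed-off-path m n y∉n P my a≢b ma mb na nb)
    start : (Σ (Matching G (lookup W)) λ n → ncovered n ≡ c × covered n y ≡ false) → ⊥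
    start (n₀ , n₀-size , n₀y) = reduce (suc (count (disagree m n₀))) n₀ ≤-refl n₀-size n₀y

-- Connected components

module _ {N} (G : Graph N) {C : Subset N} where

  reach-snoc : ∀ {a p y} → Reach G C a p → Edge G p y → y ∈ C → Reach G C a y
  reach-snoc here e y∈C = step e y∈C here
  reach-snoc (step e′ q∈C r) e y∈C = step e′ q∈C (reach-snoc r e y∈C)

  reach-trans : ∀ {a b c} → Reach G C a b → Reach G C b c → Reach G C a c
  reach-trans here r = r
  reach-trans (step e q∈C r₁) r = step e q∈C (reach-trans r₁ r)

  reach-sym : ∀ {a b} → Reach G C a b → a ∈ C → Reach G C b a
  reach-sym here _ = here
  reach-sym (step {a} {q} e q∈C r) a∈C = reach-snoc (reach-sym r q∈C) (trans (adj-sym G q a) e) a∈C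

  reach-target : ∀ {a b} → Reach G C a b → a ≡ b ⊎ b ∈ C
  reach-target here = inj₁ refl
  reach-target (step e q∈C r) with reach-target r
  ... | inj₁ refl = inj₂ q∈C
  ... | inj₂ b∈C = inj₂ b∈C

module Component {N} (G : Graph N) (W : Subset N) (z : Fin N) where

  within : ℕ → Fin N → Bool
  within zero y = y == z
  within (suc i) y = within i y ∨ (lookup W y ∧ ⌊ any? (λ p → within i p ∧ adj G p y ≟ᵇ true) ⌋)

  within-suc : ∀ i {y} → within i y ≡ true → within (suc i) y ≡ true
  within-suc i h rewrite h = refl

  within-mono : ∀ {i j y} → i ≤ j → within i y ≡ true → within j y ≡ true
  within-mono {i} {j} i≤j h with m≤n⇒m<n∨m≡n i≤j
  ... | inj₂ refl = h
  within-mono {i} {suc j} i≤j h | inj₁ i<j = within-suc j (within-mono (s≤s⁻¹ i<j) h)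

  within-edge : ∀ i {p y} → within i p ≡ true → adj G p y ≡ true → lookup W y ≡ true → within (suc i) y ≡ true
  within-edge i {p} {y} wp e Wy with any? (λ p → within i p ∧ adj G p y ≟ᵇ true)
  ... | yes _ = trans (cong (within i y ∨_) (∧-true Wy refl)) (∨-zeroʳ _)
  ... | no none = ⊥-elim (none (p , ∧-true wp e))

  within-reach : ∀ i {y} → within i y ≡ true → Reach G W z y
  within-reach zero h with ==-true h
  ... | refl = here
  within-reach (suc i) {y} h with within i y in wy
  ... | true = within-reach i wy
  ... | false with lookup W y in Wy | any? (λ p → within i p ∧ adj G p y ≟ᵇ true)
  ... | true | yes (p , e) = reach-snoc G (within-reach i (∧-trueˡ e)) (∧-trueʳ e) (true⇒∈ Wy)

  reach-within : ∀ i {p y} → within i p ≡ true → Reach G W p y → ∃ λ j → within j y ≡ true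
  reach-within i wp here = i , wp
  reach-within i wp (step e q∈W r) = reach-within (suc i) (within-edge i wp e (∈⇒true q∈W)) r

  Stable : ℕ → Set
  Stable i = ∀ y → within (suc i) y ≡ true → within i y ≡ true

  stable-forever : ∀ i → Stable i → ∀ k {y} → within (k + i) y ≡ true → within i y ≡ true
  stable-forever i stable zero h = h
  stable-forever i stable (suc k) {y} h with within (k + i) y in w
  ... | true = stable-forever i stable k w
  ... | false with lookup W y in Wy | any? (λ p → within (k + i) p ∧ adj G p y ≟ᵇ true)
  ... | true | yes (p , e) = stable y (within-edge i (stable-forever i stable k (∧-trueˡ e)) (∧-trueʳ e) Wy)

  -- Until the layers stabilise each one adds a vertex, so they stabilise within N steps.
  grow : ∀ i → (∃ λ j → j ≤ i × Stable j) ⊎ (suc i ≤ count (within i))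
  grow zero = inj₂ (≤-reflexive (sym (count-singleton z)))
  grow (suc i) with grow i
  ... | inj₁ (j , j≤i , stable) = inj₁ (j , m≤n⇒m≤1+n j≤i , stable)
  ... | inj₂ big with any? (λ y → within (suc i) y ∧ not (within i y) ≟ᵇ true)
  ... | no none = inj₁ (i , n≤1+n i , λ y h → old y h)
    where
    old : ∀ y → within (suc i) y ≡ true → within i y ≡ true
    old y h = by-cases (within i y) refl
      where
      by-cases : ∀ b → within i y ≡ b → within i y ≡ true
      by-cases true w = w
      by-cases false w = ⊥-elim (none (y , cong₂ (λ a b → a ∧ not b) h w))
  ... | yes (y , new) =
    inj₂ (≤-trans (s≤s big) (count-mono-< (within i) (within (suc i)) (λ _ → within-suc i) y
            (not-true (∧-trueʳ new)) (∧-trueˡ new)))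

  stable : ∃ λ j → j ≤ N × Stable j
  stable with grow N
  ... | inj₁ s = s
  ... | inj₂ big = ⊥-elim (<⇒≱ big (count≤N _))

  within-N : ∀ k {y} → within k y ≡ true → within N y ≡ true
  within-N k {y} h with stable
  ... | j , j≤N , stable-j with k ≤? j
  ... | yes k≤j = within-mono j≤N (within-mono k≤j h)
  ... | no k≰j = within-mono j≤N (stable-forever j stable-j (k ∸ j)
          (subst (λ t → within t y ≡ true) (sym (m∸n+n≡m (≰⇒≥ k≰j))) h))

  component : Fin N → Bool
  component = within N

  component-reach : ∀ {y} → component y ≡ true → Reach G W z y
  component-reach = within-reach N

  reach-component : ∀ {y} → Reach G W z y → component y ≡ true
  reach-component r with reach-within 0 (==-refl z) r
  ... | j , h = within-N j h

  component-self : component z ≡ true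
  component-self = reach-component here

  componentSet : Subset N
  componentSet = tabulate component

  lookup-componentSet : ∀ y → lookup componentSet y ≡ component y
  lookup-componentSet = lookup∘tabulate component

  reach-in-component : ∀ {p y} → Reach G W p y → component p ≡ true → Reach G componentSet p y
  reach-in-component here _ = here
  reach-in-component (step {p} {q} e q∈W r) cp =
    step e (true⇒∈ (trans (lookup-componentSet q) cq)) (reach-in-component r cq)
    where
    cq : component q ≡ true
    cq = reach-component (reach-snoc G (component-reach cp) e q∈W)

component-closed : ∀ {N} {G H : Graph N} {W C : Subset N} {V : Fin N → Bool} → IsComponent G W C →
  (m : Matching H V) → (∀ {x y} → adj H x y ≡ true → adj G x y ≡ true) →
  (∀ {x y} → x ∈ W → mate m x ≡ just y → y ∈ W) → Closed m (lookup C)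
component-closed {C = C} (C⊆W , _ , _ , maximal) m H⊆G W-closed {x} {y} Cx mxy with lookup C y in Cy
... | true = refl
... | false = ⊥-elim (maximal x y (true⇒∈ Cx) (W-closed (C⊆W x (true⇒∈ Cx)) mxy) (false⇒∉ Cy) (H⊆G (mate-adj m mxy)))

module _ {N} (G : Graph N) (u v : Fin N) where

  sameEdge-false : ∀ {x y} → (x ≢ u ⊎ y ≢ v) → (x ≢ v ⊎ y ≢ u) → sameEdge u v x y ≡ false
  sameEdge-false {x} {y} xy≢uv xy≢vu = cong₂ _∨_ (∧-false xy≢uv) (∧-false xy≢vu)
    where
    ∧-false : ∀ {a b c d} → (a ≢ b ⊎ c ≢ d) → (a == b) ∧ (c == d) ≡ false
    ∧-false {a} {b} (inj₁ a≢b) rewrite ==-false a≢b = refl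
    ∧-false {c = c} {d} (inj₂ c≢d) rewrite ==-false c≢d = ∧-zeroʳ _

  deleteEdge-⊆ : ∀ {x y} → adj (deleteEdge G u v) x y ≡ true → adj G x y ≡ true
  deleteEdge-⊆ = ∧-trueˡ

  deleteEdge-keeps : ∀ {x y} → adj G x y ≡ true → (x ≢ u ⊎ y ≢ v) → (x ≢ v ⊎ y ≢ u) →
    adj (deleteEdge G u v) x y ≡ true
  deleteEdge-keeps e xy≢uv xy≢vu rewrite e | sameEdge-false xy≢uv xy≢vu = refl

  deleteEdge-uv : adj (deleteEdge G u v) u v ≡ false
  deleteEdge-uv rewrite ==-refl u | ==-refl v = ∧-zeroʳ _

  deleteEdge-vu : adj (deleteEdge G u v) v u ≡ false
  deleteEdge-vu = trans (adj-sym (deleteEdge G u v) v u) deleteEdge-uv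

missing-endpoint⇒deleteEdge : ∀ {N} {G : Graph N} {W : Fin N → Bool} {u v : Fin N} → (W u ≡ false ⊎ W v ≡ false) →
  Matching G W → Matching (deleteEdge G u v) W
missing-endpoint⇒deleteEdge {G = G} {W} {u} {v} missing m = transfer m kept (mate-in m)
  where
  outside : ∀ {t} → W t ≡ false → ∀ {x y} → mate m x ≡ just y → x ≢ t × y ≢ t
  outside Wt mxy = (λ { refl → true≢false (trans (sym (mate-in m mxy)) Wt) })
                 , (λ { refl → true≢false (trans (sym (mate-in m (mate-sym m mxy))) Wt) })
  kept : ∀ {x y} → mate m x ≡ just y → adj (deleteEdge G u v) x y ≡ true
  kept {x} {y} mxy = keep missing
    where
    keep : (W u ≡ false ⊎ W v ≡ false) → adj (deleteEdge G u v) x y ≡ true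
    keep (inj₁ Wu) = deleteEdge-keeps G u v (mate-adj m mxy) (inj₁ (proj₁ (outside Wu mxy))) (inj₂ (proj₂ (outside Wu mxy)))
    keep (inj₂ Wv) = deleteEdge-keeps G u v (mate-adj m mxy) (inj₂ (proj₂ (outside Wv mxy))) (inj₁ (proj₁ (outside Wv mxy)))

-- Deciding the (n, k, d) property

module _ {A : Set} (universe : List A) (complete : ∀ a → a Mem.∈ universe) where

  listsOfLength : ℕ → List (List A)
  listsOfLength zero = [] ∷ []
  listsOfLength (suc L) = concatMap (λ a → map (a ∷_) (listsOfLength L)) universe

  ∈-listsOfLength : ∀ (xs : List A) → xs Mem.∈ listsOfLength (length xs)
  ∈-listsOfLength [] = here refl
  ∈-listsOfLength (a ∷ xs) =
    ∈-concatMap⁺ (λ e → map (e ∷_) (listsOfLength (length xs)))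
      (Any.map (λ { refl → ∈-map⁺ (_ ∷_) (∈-listsOfLength xs) }) (complete a))

  any-of-length? : (P : List A → Set) → Decidable P → ∀ L → Dec (∃ λ xs → length xs ≡ L × P xs)
  any-of-length? P P? L with Any.any? (λ xs → (length xs ≟ℕ L) ×-dec P? xs) (listsOfLength L)
  ... | yes found = yes (Any.satisfied found)
  ... | no none = no (λ { (xs , refl , p) → none (Any.map (λ { refl → refl , p }) (∈-listsOfLength xs)) })

  any-of-length≤? : (P : List A → Set) → Decidable P → ∀ B → Dec (∃ λ xs → length xs ≤ B × P xs)
  any-of-length≤? P P? zero with any-of-length? P P? zero
  ... | yes (xs , len , p) = yes (xs , ≤-reflexive len , p)
  ... | no none = no (λ { (xs , len , p) → none (xs , n≤0⇒n≡0 len , p) })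
  any-of-length≤? P P? (suc B) with any-of-length? P P? (suc B) | any-of-length≤? P P? B
  ... | yes (xs , len , p) | _ = yes (xs , ≤-reflexive len , p)
  ... | no _ | yes (xs , len , p) = yes (xs , m≤n⇒m≤1+n len , p)
  ... | no none | no none≤ = no λ { (xs , len , p) → shorter xs len p }
    where
    shorter : ∀ xs → length xs ≤ suc B → P xs → ⊥
    shorter xs len p with m≤n⇒m<n∨m≡n len
    ... | inj₁ len< = none≤ (xs , s≤s⁻¹ len< , p)
    ... | inj₂ len≡ = none (xs , len≡ , p)

module _ {N : ℕ} where
  open import Data.List.Relation.Unary.Unique.DecPropositional (_≟_ {N}) using (unique?)
  open import Data.List.Membership.DecPropositional (≡-dec× (_≟_ {N}) (_≟_ {N})) using () renaming (_∈?_ to _∈ₑ?_)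

  allPairs : List (Fin N × Fin N)
  allPairs = cartesianProduct (allFin N) (allFin N)

  ∈-allPairs : ∀ e → e Mem.∈ allPairs
  ∈-allPairs (a , b) = ∈-cartesianProduct⁺ (∈-allFin a) (∈-allFin b)

  isMatching? : (H : Graph N) (W : Subset N) → Decidable (IsMatching H W)
  isMatching? H W M =
    All.all? (λ e → (adj H (proj₁ e) (proj₂ e) ≟ᵇ true) ×-dec ((proj₁ e ∈ˢ? W) ×-dec (proj₂ e ∈ˢ? W))) M
      ×-dec unique? (endpoints M)

  extends? : ∀ M → Decidable (Extends {N} M)
  extends? M M′ = All.all? (λ e → (e ∈ₑ? M′) ⊎-dec (swapE e ∈ₑ? M′)) M

  -- A defect-d matching has at most N edges, so only finitely many candidates need checking.
  extendsToDefect? : (H : Graph N) (W : Subset N) (d : ℕ) (M : List (Fin N × Fin N)) →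
    Dec (∃ λ M′ → IsDefectMatching H W d M′ × Extends M M′)
  extendsToDefect? H W d M
    with any-of-length≤? allPairs ∈-allPairs (λ M′ → IsDefectMatching H W d M′ × Extends M M′)
           (λ M′ → (isMatching? H W M′ ×-dec (2 * length M′ + d ≟ℕ ∣ W ∣)) ×-dec extends? M M′) N
  ... | yes (M′ , _ , p) = yes (M′ , p)
  ... | no none = no λ { (M′ , p) → none (M′ , short M′ (proj₂ (proj₁ p)) , p) }
    where
    short : ∀ M′ → 2 * length M′ + d ≡ ∣ W ∣ → length M′ ≤ N
    short M′ e = begin
      length M′           ≤⟨ m≤m*n (length M′) 2 ⟩
      length M′ * 2       ≡⟨ *-comm (length M′) 2 ⟩
      2 * length M′       ≤⟨ m≤m+n _ d ⟩
      2 * length M′ + d   ≡⟨ e ⟩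
      ∣ W ∣               ≤⟨ ∣p∣≤n W ⟩
      N                   ∎
      where open ≤-Reasoning

  Obstruction : (H : Graph N) (n k d : ℕ) → Set
  Obstruction H n k d = Σ (Subset N) λ S → ∣ S ∣ ≡ n × Σ (List (Fin N × Fin N)) λ M →
    IsKMatching H (∁ S) k M × ¬ (∃ λ M′ → IsDefectMatching H (∁ S) d M′ × Extends M M′)

  obstruction? : (H : Graph N) (n k d : ℕ) → Dec (Obstruction H n k d)
  obstruction? H n k d = anySubset? (λ S → (∣ S ∣ ≟ℕ n) ×-dec bad? S)
    where
    bad? : ∀ S → Dec (Σ (List (Fin N × Fin N)) λ M →
      IsKMatching H (∁ S) k M × ¬ (∃ λ M′ → IsDefectMatching H (∁ S) d M′ × Extends M M′))
    bad? S with any-of-length? allPairs ∈-allPairs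
       (λ M → IsMatching H (∁ S) M × ¬ (∃ λ M′ → IsDefectMatching H (∁ S) d M′ × Extends M M′))
       (λ M → isMatching? H (∁ S) M ×-dec ¬? (extendsToDefect? H (∁ S) d M)) k
    ... | yes (M , len , matching , stuck) = yes (M , (matching , len) , stuck)
    ... | no none = no λ { (M , (matching , len) , stuck) → none (M , len , matching , stuck) }

module _ {N} {H : Graph N} where

  ncovered-even : ∀ {W} (m : Matching H W) → 2 ∣ ncovered m
  ncovered-even {W} m with toIsMatching m (tabulate W) (λ {x} Wx → trans (lookup∘tabulate W x) Wx)
  ... | L , _ , size , _ = divides (length L) (trans (sym size) (*-comm 2 (length L)))

  closed-covered-even : ∀ {W} (m : Matching H W) (C : Fin N → Bool) → Closed m C →
    (∀ y → C y ≡ true → covered m y ≡ true) → 2 ∣ count C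
  closed-covered-even m C closed C-covered =
    subst (2 ∣_) (count-cong all-covered) (ncovered-even (restrict m C closed))
    where
    all-covered : ∀ y → covered (restrict m C closed) y ≡ C y
    all-covered y rewrite restrict-covered m C closed y with C y in Cy
    ... | true = trans (∧-identityʳ _) (C-covered y Cy)
    ... | false = ∧-zeroʳ _

  count-uncovered : ∀ {W} (m : Matching H W) → count W ≡ ncovered m + count (λ y → W y ∧ not (covered m y))
  count-uncovered {W} m = count-partition W (covered m) (covered m) _ W∧covered (λ _ → refl)
    where
    W∧covered : ∀ y → W y ∧ covered m y ≡ covered m y
    W∧covered y with covered m y in c
    ... | true = trans (∧-identityʳ _) (covered⇒in m c)
    ... | false = ∧-zeroʳ _

factorCritical⇒odd : ∀ {N} {G : Graph N} {C : Subset N} {w} → FactorCritical G C → w ∈ C → Odd ∣ C ∣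
factorCritical⇒odd {C = C} {w} critical w∈C 2∣C with critical w w∈C
... | L , _ , size = odd-suc (subst (2 ∣_) (trans (∣∣-remove C w∈C) (cong suc (sym size))) 2∣C)
  where
  odd-suc : ¬ (2 ∣ suc (2 * length L))
  odd-suc 2∣ with ∣1⇒≡1 (∣m+n∣m⇒∣n (subst (2 ∣_) (+-comm 1 (2 * length L)) 2∣) (divides (length L) (*-comm 2 (length L))))
  ... | ()

-- The barrier rules out the (n - 2, k, d) property of G - uv

EdgeBarrier : ∀ {N} → Graph N → Fin N → Fin N → ℕ → ℕ → ℕ → Set
EdgeBarrier {N} G u v n k d = ∃ λ (S : Subset N) → ∣ S ∣ ≡ n ∸ 2 + 2 * k
  × (∃ λ M → IsKMatching G S k M)
  × (∃ λ (Cs : Vec (Subset N) d) →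
       (∀ i → Odd ∣ lookup Cs i ∣ × FactorCritical G (lookup Cs i))
       × DisjointUnionOfComponents G (∁ S) ((⁅ u ⁆ ∪ ⁅ v ⁆) ∷ Cs))

module Sufficiency {N} (G : Graph N) (u v : Fin N) (uv : Edge G u v) (n k d : ℕ)
  (S : Subset N) (S-size : ∣ S ∣ ≡ n ∸ 2 + 2 * k)
  (M : List (Fin N × Fin N)) (M-matching : IsKMatching G S k M)
  (Cs : Vec (Subset N) d) (Cs-odd : ∀ i → Odd ∣ lookup Cs i ∣)
  (partition : DisjointUnionOfComponents G (∁ S) ((⁅ u ⁆ ∪ ⁅ v ⁆) ∷ Cs)) where

  H′ : Graph N
  H′ = deleteEdge G u v

  parts : Vec (Subset N) (suc d)
  parts = (⁅ u ⁆ ∪ ⁅ v ⁆) ∷ Cs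

  isComponent : ∀ i → IsComponent G (∁ S) (lookup parts i)
  isComponent = proj₁ partition

  disjoint : ∀ i j → i ≢ j → Empty (lookup parts i ∩ lookup parts j)
  disjoint = proj₁ (proj₂ partition)

  covers⇒S : ∀ {x} → covers M x ≡ true → lookup S x ≡ true
  covers⇒S h = ∈⇒true (endpoint-in {H = G} (proj₁ M-matching) (covers⇒∈ {M = M} h))

  S₀ : Subset N
  S₀ = tabulate (λ x → lookup S x ∧ not (covers M x))

  lookup-S₀ : ∀ x → lookup S₀ x ≡ lookup S x ∧ not (covers M x)
  lookup-S₀ = lookup∘tabulate _

  S₀-size : ∣ S₀ ∣ ≡ n ∸ 2
  S₀-size = +-cancelˡ-≡ (2 * k) _ _ (begin
      2 * k + ∣ S₀ ∣
    ≡⟨ cong₂ _+_ (sym M-size) (trans (∣∣≡count S₀) (count-cong lookup-S₀)) ⟩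
      count (covers M) + count (λ x → lookup S x ∧ not (covers M x))
    ≡⟨ sym (count-partition (lookup S) (covers M) (covers M) _ S∧covers (λ _ → refl)) ⟩
      count (lookup S)
    ≡⟨ sym (∣∣≡count S) ⟩
      ∣ S ∣
    ≡⟨ trans S-size (+-comm (n ∸ 2) (2 * k)) ⟩
      2 * k + (n ∸ 2)
    ∎)
    where
    open ≡-Reasoning
    M-size : count (covers M) ≡ 2 * k
    M-size = trans (count-covers M (proj₂ (proj₁ M-matching))) (cong (2 *_) (proj₂ M-matching))
    S∧covers : ∀ x → lookup S x ∧ covers M x ≡ covers M x
    S∧covers x with covers M x in c
    ... | true = trans (∧-identityʳ _) (covers⇒S c)
    ... | false = ∧-zeroʳ _

  u∈part : u ∈ lookup parts zero
  u∈part = x∈p∪q⁺ (inj₁ (x∈⁅x⁆ u))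

  v∈part : v ∈ lookup parts zero
  v∈part = x∈p∪q⁺ (inj₂ (x∈⁅x⁆ v))

  u∉S : lookup S u ≡ false
  u∉S = ∈∁⇒false (proj₁ (isComponent zero) u u∈part)

  v∉S : lookup S v ≡ false
  v∉S = ∈∁⇒false (proj₁ (isComponent zero) v v∈part)

  S⇒≢ : ∀ {x} → lookup S x ≡ true → x ≢ u × x ≢ v
  S⇒≢ h = (λ { refl → true≢false (trans (sym h) u∉S) }) , (λ { refl → true≢false (trans (sym h) v∉S) })

  M-in-H′ : IsKMatching H′ (∁ S₀) k M
  M-in-H′ = IsMatching-transfer {H = G} {H′} {S} {∁ S₀} (proj₁ M-matching) edge-in-H′ in-∁S₀ , proj₂ M-matching
    where
    edge-in-H′ : ∀ {x y} → (x , y) Mem.∈ M → adj H′ x y ≡ true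
    edge-in-H′ p with All.lookup (proj₁ (proj₁ M-matching)) p
    ... | e , x∈S , _ = deleteEdge-keeps G u v e (inj₁ (proj₁ (S⇒≢ (∈⇒true x∈S)))) (inj₁ (proj₂ (S⇒≢ (∈⇒true x∈S))))
    in-∁S₀ : ∀ {x} → x Mem.∈ endpoints M → x ∈ ∁ S₀
    in-∁S₀ {x} x∈M = true⇒∈ (trans (lookup-∁ S₀ x) (cong not (trans (lookup-S₀ x)
      (trans (cong (λ b → lookup S x ∧ not b) (∈⇒covers {M = M} x∈M)) (∧-zeroʳ _)))))

  module _ (M′ : List (Fin N × Fin N)) (M′-matching : IsMatching H′ (∁ S₀) M′)
    (M′-defect : 2 * length M′ + d ≡ ∣ ∁ S₀ ∣) (M⊆M′ : Extends M M′) where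

    m′ = fromIsMatching {H = H′} (∁ S₀) M′ M′-matching

    ∁S-closed : ∀ {x y} → x ∈ ∁ S → mate m′ x ≡ just y → y ∈ ∁ S
    ∁S-closed {x} {y} x∈∁S mxy with covers M y in My
    ... | true = ⊥-elim (true≢false (trans (sym (covers⇒S (extends-closed {H = H′} M M′ M′-matching M⊆M′ My (mate-sym m′ mxy))))
                   (∈∁⇒false x∈∁S)))
    ... | false = true⇒∈ (trans (lookup-∁ S y) (cong not y∉S))
      where
      y∉S : lookup S y ≡ false
      y∉S with lookup S y in Sy
      ... | false = refl
      ... | true = ⊥-elim (true≢false (trans (sym (mate-in m′ (mate-sym m′ mxy)))
                     (trans (lookup-∁ S₀ y) (cong not (trans (lookup-S₀ y) (cong₂ (λ a b → a ∧ not b) Sy My))))))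

    part-closed : ∀ i → Closed m′ (lookup (lookup parts i))
    part-closed i = component-closed (isComponent i) m′ (deleteEdge-⊆ G u v) ∁S-closed

    u,v-uncovered : ∀ {x} → x ∈ lookup parts zero → covered m′ x ≡ false
    u,v-uncovered {x} x∈uv with mate m′ x in mx
    ... | nothing = refl
    ... | just y with x∈⁅u,v⁆ x∈uv | x∈⁅u,v⁆ (true⇒∈ (part-closed zero (∈⇒true x∈uv) mx))
      where
      x∈⁅u,v⁆ : ∀ {x} → x ∈ ⁅ u ⁆ ∪ ⁅ v ⁆ → x ≡ u ⊎ x ≡ v
      x∈⁅u,v⁆ h with x∈p∪q⁻ ⁅ u ⁆ ⁅ v ⁆ h
      ... | inj₁ x∈u = inj₁ (x∈⁅y⁆⇒x≡y u x∈u)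
      ... | inj₂ x∈v = inj₂ (x∈⁅y⁆⇒x≡y v x∈v)
    ... | inj₁ refl | inj₁ refl = ⊥-elim (mate-irrefl m′ mx refl)
    ... | inj₂ refl | inj₂ refl = ⊥-elim (mate-irrefl m′ mx refl)
    ... | inj₁ refl | inj₂ refl = ⊥-elim (true≢false (trans (sym (mate-adj m′ mx)) (deleteEdge-uv G u v)))
    ... | inj₂ refl | inj₁ refl = ⊥-elim (true≢false (trans (sym (mate-adj m′ mx)) (deleteEdge-vu G u v)))

    -- An odd component closed under m′ cannot be covered by it.
    missed-in : ∀ i → ∃ λ y → y ∈ lookup Cs i × covered m′ y ≡ false
    missed-in i with any? (λ y → lookup (lookup Cs i) y ∧ not (covered m′ y) ≟ᵇ true)
    ... | yes (y , h) = y , true⇒∈ (∧-trueˡ h) , not-true (∧-trueʳ h)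
    ... | no none = ⊥-elim (Cs-odd i (subst (2 ∣_) (sym (∣∣≡count (lookup Cs i)))
                      (closed-covered-even m′ _ (part-closed (suc i)) all-covered)))
      where
      all-covered : ∀ y → lookup (lookup Cs i) y ≡ true → covered m′ y ≡ true
      all-covered y Cy with covered m′ y in c
      ... | true = refl
      ... | false = ⊥-elim (none (y , cong₂ (λ a b → a ∧ not b) Cy c))

    missed : Fin (suc (suc d)) → Fin N
    missed zero = u
    missed (suc zero) = v
    missed (suc (suc i)) = proj₁ (missed-in i)

    part-of : Fin (suc (suc d)) → Fin (suc d)
    part-of zero = zero
    part-of (suc zero) = zero
    part-of (suc (suc i)) = suc i

    missed∈part : ∀ i → missed i ∈ lookup parts (part-of i)
    missed∈part zero = u∈part
    missed∈part (suc zero) = v∈part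
    missed∈part (suc (suc i)) = proj₁ (proj₂ (missed-in i))

    missed-injective : ∀ i j → missed i ≡ missed j → i ≡ j
    missed-injective i j same with part-of i ≟ part-of j
    ... | no differ = ⊥-elim (disjoint _ _ differ (missed i , x∈p∩q⁺ (missed∈part i , subst (_∈ _) (sym same) (missed∈part j))))
    missed-injective zero zero same | yes _ = refl
    missed-injective zero (suc zero) same | yes _ = ⊥-elim (adj-irrefl G uv same)
    missed-injective (suc zero) zero same | yes _ = ⊥-elim (adj-irrefl G uv (sym same))
    missed-injective (suc zero) (suc zero) same | yes _ = refl
    missed-injective (suc (suc i)) (suc (suc j)) same | yes refl = refl

    missed-uncovered : ∀ i → lookup (∁ S₀) (missed i) ∧ not (covered m′ (missed i)) ≡ true
    missed-uncovered i = ∧-true (∁S⊆∁S₀ (proj₁ (isComponent (part-of i)) _ (missed∈part i))) (cong not (uncovered i))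
      where
      ∁S⊆∁S₀ : ∀ {x} → x ∈ ∁ S → lookup (∁ S₀) x ≡ true
      ∁S⊆∁S₀ {x} x∈∁S = trans (lookup-∁ S₀ x) (cong not (trans (lookup-S₀ x) (cong (_∧ _) (∈∁⇒false x∈∁S))))
      uncovered : ∀ i → covered m′ (missed i) ≡ false
      uncovered zero = u,v-uncovered u∈part
      uncovered (suc zero) = u,v-uncovered v∈part
      uncovered (suc (suc i)) = proj₂ (proj₂ (missed-in i))

    too-many-missed : ⊥
    too-many-missed = 1+n≰n (begin
        suc d
      ≤⟨ n≤1+n (suc d) ⟩
        suc (suc d)
      ≤⟨ count-injection (suc (suc d)) _ missed missed-injective missed-uncovered ⟩
        count (λ y → lookup (∁ S₀) y ∧ not (covered m′ y))
      ≡⟨ +-cancelˡ-≡ (ncovered m′) _ _ (begin-equality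
           ncovered m′ + count (λ y → lookup (∁ S₀) y ∧ not (covered m′ y))
         ≡⟨ sym (count-uncovered m′) ⟩
           count (lookup (∁ S₀))
         ≡⟨ sym (∣∣≡count (∁ S₀)) ⟩
           ∣ ∁ S₀ ∣
         ≡⟨ sym M′-defect ⟩
           2 * length M′ + d
         ≡⟨ cong (_+ d) (sym (fromIsMatching-ncovered {H = H′} (∁ S₀) M′ M′-matching)) ⟩
           ncovered m′ + d
         ∎) ⟩
        d
      ∎)
      where open ≤-Reasoning

  not-NKD : ¬ IsNKDGraph (n ∸ 2) k d H′
  not-NKD (_ , _ , property) with proj₂ (property S₀ S₀-size) M M-in-H′
  ... | M′ , (M′-matching , M′-defect) , M⊆M′ = too-many-missed M′ M′-matching M′-defect M⊆M′

barrier⇒¬NKD : ∀ {N} (G : Graph N) (u v : Fin N) → Edge G u v → ∀ n k d →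
  EdgeBarrier G u v n k d → ¬ IsNKDGraph (n ∸ 2) k d (deleteEdge G u v)
barrier⇒¬NKD G u v uv n k d (S , S-size , (M , M-matching) , Cs , Cs-odd-critical , partition) =
  Sufficiency.not-NKD G u v uv n k d S S-size M M-matching Cs (λ i → proj₁ (Cs-odd-critical i)) partition

-- An obstruction to the (n - 2, k, d) property of G - uv

module Obstructed {N} (G : Graph N) (u v : Fin N) (uv : Edge G u v) (n k d : ℕ) (2≤n : 2 ≤ n)
  (nkd : IsNKDGraph n k d G) (S₀ : Subset N) (S₀-size : ∣ S₀ ∣ ≡ n ∸ 2)
  (M : List (Fin N × Fin N)) (M-matching : IsKMatching (deleteEdge G u v) (∁ S₀) k M)
  (stuck : ¬ (∃ λ M′ → IsDefectMatching (deleteEdge G u v) (∁ S₀) d M′ × Extends M M′)) where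

  H′ : Graph N
  H′ = deleteEdge G u v

  u≢v : u ≢ v
  u≢v = adj-irrefl G uv

  covers⇒∉S₀ : ∀ {x} → covers M x ≡ true → lookup S₀ x ≡ false
  covers⇒∉S₀ h = ∈∁⇒false (endpoint-in {H = H′} (proj₁ M-matching) (covers⇒∈ {M = M} h))

  T : Fin N → Bool
  T x = not (lookup S₀ x) ∧ not (covers M x)

  M-size : count (covers M) ≡ 2 * k
  M-size = trans (count-covers M (proj₂ (proj₁ M-matching))) (cong (2 *_) (proj₂ M-matching))

  count-∁S₀ : count (lookup (∁ S₀)) ≡ 2 * k + count T
  count-∁S₀ = trans (count-partition (lookup (∁ S₀)) (covers M) (covers M) T ∁S₀∧covers (λ x → cong (_∧ _) (lookup-∁ S₀ x)))
                (cong (_+ count T) M-size)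
    where
    ∁S₀∧covers : ∀ x → lookup (∁ S₀) x ∧ covers M x ≡ covers M x
    ∁S₀∧covers x with covers M x in c
    ... | true = trans (∧-identityʳ _) (trans (lookup-∁ S₀ x) (cong not (covers⇒∉S₀ c)))
    ... | false = ∧-zeroʳ _

  T-large : d + 4 ≤ count T
  T-large = +-cancelˡ-≤ (n ∸ 2 + 2 * k) _ _ (begin
      n ∸ 2 + 2 * k + (d + 4)     ≡⟨ shuffle (n ∸ 2) (2 * k) d ⟩
      (n ∸ 2 + 2) + 2 * k + d + 2 ≡⟨ cong (λ m → m + 2 * k + d + 2) (m∸n+n≡m 2≤n) ⟩
      n + 2 * k + d + 2           ≤⟨ proj₁ nkd ⟩
      N                           ≡⟨ N-size ⟩
      n ∸ 2 + 2 * k + count T     ∎)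
    where
    open ≤-Reasoning
    shuffle : ∀ a b c → a + b + (c + 4) ≡ a + 2 + b + c + 2
    shuffle = solve-∀
    N-size : N ≡ n ∸ 2 + 2 * k + count T
    N-size = begin-equality
      N                            ≡⟨ sym (∣p∣+∣∁p∣≡n S₀) ⟩
      ∣ S₀ ∣ + ∣ ∁ S₀ ∣            ≡⟨ cong₂ _+_ S₀-size (trans (∣∣≡count (∁ S₀)) count-∁S₀) ⟩
      n ∸ 2 + (2 * k + count T)    ≡⟨ sym (+-assoc (n ∸ 2) (2 * k) (count T)) ⟩
      n ∸ 2 + 2 * k + count T      ∎

  T∖ : Fin N → Fin N → Fin N → Bool
  T∖ x y z = T z ∧ avoiding x y z

  module _ {x y z : Fin N} where

    T∖⇒T : T∖ x y z ≡ true → T z ≡ true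
    T∖⇒T = ∧-trueˡ

    T∖⇒≢₁ : T∖ x y z ≡ true → z ≢ x
    T∖⇒≢₁ h refl rewrite ==-refl z = true≢false (sym (∧-trueʳ {T z} h))

    T∖⇒≢₂ : T∖ x y z ≡ true → z ≢ y
    T∖⇒≢₂ h refl rewrite ==-refl z = true≢false (trans (sym (∧-trueʳ {T z} h)) (∧-zeroʳ _))

    T∖-intro : T z ≡ true → z ≢ x → z ≢ y → T∖ x y z ≡ true
    T∖-intro Tz z≢x z≢y rewrite Tz | ==-false z≢x | ==-false z≢y = refl

  T∖-left : ∀ x y → T∖ x y x ≡ false
  T∖-left x y with T∖ x y x in h
  ... | true = ⊥-elim (T∖⇒≢₁ h refl)
  ... | false = refl

  T∖-right : ∀ x y → T∖ x y y ≡ false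
  T∖-right x y with T∖ x y y in h
  ... | true = ⊥-elim (T∖⇒≢₂ h refl)
  ... | false = refl

  count-T∖ : ∀ {x y} → T x ≡ true → T y ≡ true → x ≢ y → count T ≡ suc (suc (count (T∖ x y)))
  count-T∖ {x} {y} Tx Ty x≢y =
    trans (count-remove T x Tx) (cong suc (trans (count-remove _ y (∧-true Ty (cong not (==-false (λ e → x≢y (sym e))))))
      (cong suc (count-cong (λ z → ∧-assoc (T z) _ _)))))

  -- Deleting S₀ and two vertices x, y of T leaves n vertices deleted, so M extends in G.
  matching-after-removing : ∀ {x y} → T x ≡ true → T y ≡ true → x ≢ y →
    Σ (Matching G (T∖ x y)) λ m → ncovered m + d ≡ count (T∖ x y)
  matching-after-removing {x} {y} Tx Ty x≢y = m , +-cancelˡ-≡ (2 * k) _ _ (begin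
      2 * k + (ncovered m + d)            ≡⟨ sym (+-assoc (2 * k) _ d) ⟩
      2 * k + ncovered m + d              ≡⟨ cong (λ c → c + ncovered m + d) (sym M-size) ⟩
      count (covers M) + ncovered m + d   ≡⟨ cong (_+ d) (sym (beyond-ncovered {H = G} M M″ M″-matching M⊆M″)) ⟩
      2 * length M″ + d                   ≡⟨ M″-defect ⟩
      ∣ ∁ Z ∣                             ≡⟨ ∣∣≡count (∁ Z) ⟩
      count (lookup (∁ Z))                ≡⟨ ∁Z-split ⟩
      2 * k + count (T∖ x y)              ∎)
    where
    open ≡-Reasoning
    Z = addTwo S₀ x y
    ∁Z∖M : ∀ z → lookup (∁ Z) z ∧ not (covers M z) ≡ T∖ x y z
    ∁Z∖M z rewrite lookup-∁addTwo S₀ {x} {y} z with lookup S₀ z | covers M z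
    ... | true | _ = refl
    ... | false | true = ∧-zeroʳ _
    ... | false | false = ∧-identityʳ _
    covers⇒∁Z : ∀ {z} → covers M z ≡ true → lookup (∁ Z) z ≡ true
    covers⇒∁Z {z} h rewrite lookup-∁addTwo S₀ {x} {y} z | covers⇒∉S₀ h
      | ==-false {x = z} {x} (λ { refl → true≢false (trans (sym h) (not-true (∧-trueʳ Tx))) })
      | ==-false {x = z} {y} (λ { refl → true≢false (trans (sym h) (not-true (∧-trueʳ Ty))) }) = refl
    M-in-G : IsKMatching G (∁ Z) k M
    M-in-G = IsMatching-transfer {H = H′} {G} {∁ S₀} {∁ Z} (proj₁ M-matching)
               (λ p → deleteEdge-⊆ G u v (proj₁ (All.lookup (proj₁ (proj₁ M-matching)) p)))
               (λ z∈M → true⇒∈ (covers⇒∁Z (∈⇒covers {M = M} z∈M)))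
           , proj₂ M-matching
    Z-size : ∣ Z ∣ ≡ n
    Z-size = trans (∣addTwo∣ S₀ (not-true (∧-trueˡ Tx)) (not-true (∧-trueˡ Ty)) x≢y) (trans (cong (_+ 2) S₀-size) (m∸n+n≡m 2≤n))
    extension = proj₂ (proj₂ (proj₂ nkd) Z Z-size) M M-in-G
    M″ = proj₁ extension
    M″-matching = proj₁ (proj₁ (proj₂ extension))
    M″-defect = proj₂ (proj₁ (proj₂ extension))
    M⊆M″ = proj₂ (proj₂ extension)
    m-off = beyond {H = G} M M″ M″-matching M⊆M″
    m : Matching G (T∖ x y)
    m = transfer m-off (mate-adj m-off) (λ {z} e → trans (sym (∁Z∖M z)) (mate-in m-off e))
    ∁Z-split : count (lookup (∁ Z)) ≡ 2 * k + count (T∖ x y)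
    ∁Z-split = trans (count-partition (lookup (∁ Z)) (covers M) (covers M) (T∖ x y) on-M ∁Z∖M) (cong (_+ count (T∖ x y)) M-size)
      where
      on-M : ∀ z → lookup (∁ Z) z ∧ covers M z ≡ covers M z
      on-M z with covers M z in c
      ... | true = trans (∧-identityʳ _) (covers⇒∁Z c)
      ... | false = ∧-zeroʳ _

  -- Otherwise M together with such a matching would be an extension of M of defect d.
  no-defect-d-matching : (m : Matching H′ T) → ncovered m + d ≡ count T → ⊥
  no-defect-d-matching m size = stuck (M ++ L , (M++L-matching , M++L-defect) , All.tabulate (λ p → inj₁ (∈-++⁺ˡ p)))
    where
    converted = toIsMatching m (∁ S₀) (λ {z} Tz → trans (lookup-∁ S₀ z) (∧-trueˡ Tz))
    L = proj₁ converted
    L-matching = proj₁ (proj₂ converted)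
    L-size = proj₁ (proj₂ (proj₂ converted))
    L-covered = proj₂ (proj₂ (proj₂ converted))
    endpoints-++ : ∀ (xs ys : List (Fin N × Fin N)) → endpoints (xs ++ ys) ≡ endpoints xs ++ endpoints ys
    endpoints-++ [] ys = refl
    endpoints-++ ((a , b) ∷ xs) ys = cong (λ t → a ∷ b ∷ t) (endpoints-++ xs ys)
    M++L-matching : IsMatching H′ (∁ S₀) (M ++ L)
    M++L-matching = All-++⁺ (proj₁ (proj₁ M-matching)) (proj₁ L-matching) ,
      subst Unique (sym (endpoints-++ M L))
        (Unique.++⁺ (proj₂ (proj₁ M-matching)) (proj₂ L-matching)
          (λ (z∈M , z∈L) → true≢false (trans (sym (∈⇒covers {M = M} z∈M))
                              (not-true (∧-trueʳ (covered⇒in m (L-covered z∈L)))))))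
    M++L-defect : 2 * length (M ++ L) + d ≡ ∣ ∁ S₀ ∣
    M++L-defect = begin
        2 * length (M ++ L) + d         ≡⟨ cong (λ t → 2 * t + d) (length-++ M) ⟩
        2 * (length M + length L) + d   ≡⟨ cong (λ t → 2 * (t + length L) + d) (proj₂ M-matching) ⟩
        2 * (k + length L) + d          ≡⟨ distribute k (length L) d ⟩
        2 * k + (2 * length L + d)      ≡⟨ cong (λ t → 2 * k + (t + d)) L-size ⟩
        2 * k + (ncovered m + d)        ≡⟨ cong (2 * k +_) size ⟩
        2 * k + count T                 ≡⟨ sym count-∁S₀ ⟩
        count (lookup (∁ S₀))           ≡⟨ sym (∣∣≡count (∁ S₀)) ⟩
        ∣ ∁ S₀ ∣                        ∎
      where
      open ≡-Reasoning
      distribute : ∀ a b c → 2 * (a + b) + c ≡ 2 * a + (2 * b + c)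
      distribute = solve-∀

  -- Adding an edge xy ≠ uv to the matching of T - x - y would give one of defect d in G - uv.
  no-edge-inside : ∀ {x y} → T x ≡ true → T y ≡ true → adj G x y ≡ true → (x ≢ u ⊎ y ≢ v) → (x ≢ v ⊎ y ≢ u) →
    (T∖ x y u ≡ false ⊎ T∖ x y v ≡ false) → ⊥
  no-edge-inside {x} {y} Tx Ty e xy≢uv xy≢vu u-or-v-missing =
    no-defect-d-matching (addEdge m′ x y x∉m′ y∉m′ x≢y (deleteEdge-keeps G u v e xy≢uv xy≢vu) Tx Ty)
      (trans (cong (_+ d) (addEdge-ncovered m′ x y x∉m′ y∉m′ x≢y (deleteEdge-keeps G u v e xy≢uv xy≢vu) Tx Ty)) (trans (cong (λ c → suc (suc c)) size)
        (sym (count-T∖ Tx Ty x≢y))))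
    where
    x≢y = adj-irrefl G e
    removed = matching-after-removing Tx Ty x≢y
    m = proj₁ removed
    size = proj₂ removed
    m′ : Matching H′ T
    m′ = transfer m-H′ (mate-adj m-H′) (λ e → T∖⇒T (mate-in m e))
      where m-H′ = missing-endpoint⇒deleteEdge u-or-v-missing m
    uncovered : ∀ {t} → T∖ x y t ≡ false → mate m′ t ≡ nothing
    uncovered {t} h with mate m t in mt
    ... | nothing = refl
    ... | just _ = ⊥-elim (true≢false (trans (sym (mate-in m mt)) h))
    x∉m′ = uncovered (T∖-left x y)
    y∉m′ = uncovered (T∖-right x y)

  -- T spans at least d + 4 vertices, but a matching of T - x - y misses only d of them.
  T-has-edge : ∃ λ x → ∃ λ y → T x ≡ true × T y ≡ true × adj G x y ≡ true
  T-has-edge with count-witness T (≤-trans (s≤s z≤n) (m+n≤o⇒n≤o d T-large))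
  ... | x , Tx with count-witness (λ z → T z ∧ not (z == x))
                     (≤-trans (s≤s z≤n) (s≤s⁻¹ (≤-trans (m+n≤o⇒n≤o d T-large) (≤-reflexive (count-remove T x Tx)))))
  ... | y , Ty∧y≢x = edge-of (proj₁ removed) (proj₂ removed)
    where
    x≢y : x ≢ y
    x≢y refl rewrite ==-refl x = true≢false (trans (sym Ty∧y≢x) (∧-zeroʳ _))
    removed = matching-after-removing Tx (∧-trueˡ Ty∧y≢x) x≢y
    edge-of : (m : Matching G (T∖ x y)) → ncovered m + d ≡ count (T∖ x y) → ∃ λ x → ∃ λ y → T x ≡ true × T y ≡ true × adj G x y ≡ true
    edge-of m size with count-witness (covered m) (≤-trans (s≤s z≤n) (+-cancelʳ-≤ d 2 _ (begin
        2 + d                    ≤⟨ +-cancelˡ-≤ 2 _ _ (subst₂ _≤_ (+-comm d 4) (count-T∖ Tx (∧-trueˡ Ty∧y≢x) x≢y) T-large) ⟩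
        count (T∖ x y)           ≡⟨ sym size ⟩
        ncovered m + d           ∎)))
      where open ≤-Reasoning
    ... | z , covered-z with covered⇒mate m covered-z
    ... | w , mzw = z , w , T∖⇒T (mate-in m mzw) , T∖⇒T (mate-in m (mate-sym m mzw)) , mate-adj m mzw

  u∈T : T u ≡ true
  u∈T with T u in Tu
  ... | true = refl
  ... | false = ⊥-elim (use-edge T-has-edge)
    where
    ≢u : ∀ {z} → T z ≡ true → z ≢ u
    ≢u Tz refl = true≢false (trans (sym Tz) Tu)
    use-edge : (∃ λ x → ∃ λ y → T x ≡ true × T y ≡ true × adj G x y ≡ true) → ⊥
    use-edge (x , y , Tx , Ty , e) = no-edge-inside Tx Ty e (inj₁ (≢u Tx)) (inj₂ (≢u Ty)) (inj₁ (cong (_∧ _) Tu))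

  v∈T : T v ≡ true
  v∈T with T v in Tv
  ... | true = refl
  ... | false = ⊥-elim (use-edge T-has-edge)
    where
    ≢v : ∀ {z} → T z ≡ true → z ≢ v
    ≢v Tz refl = true≢false (trans (sym Tz) Tv)
    use-edge : (∃ λ x → ∃ λ y → T x ≡ true × T y ≡ true × adj G x y ≡ true) → ⊥
    use-edge (x , y , Tx , Ty , e) = no-edge-inside Tx Ty e (inj₂ (≢v Ty)) (inj₁ (≢v Tx)) (inj₂ (cong (_∧ _) Tv))

  u-isolated : ∀ {w} → T w ≡ true → w ≢ v → adj G u w ≡ true → ⊥
  u-isolated Tw w≢v e =
    no-edge-inside u∈T Tw e (inj₂ w≢v) (inj₂ (λ w≡u → adj-irrefl G e (sym w≡u))) (inj₁ (T∖-left u _))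

  v-isolated : ∀ {w} → T w ≡ true → w ≢ u → adj G v w ≡ true → ⊥
  v-isolated Tw w≢u e =
    no-edge-inside v∈T Tw e (inj₁ (λ v≡u → u≢v (sym v≡u))) (inj₂ w≢u) (inj₂ (T∖-left v _))

  -- The rest of T: G restricted to it has maximum matchings missing exactly d vertices.
  W : Subset N
  W = tabulate (T∖ u v)

  lookup-W : ∀ z → lookup W z ≡ T∖ u v z
  lookup-W = lookup∘tabulate (T∖ u v)

  maximum : Σ (Matching G (T∖ u v)) λ m → ncovered m + d ≡ count (T∖ u v)
  maximum = matching-after-removing u∈T v∈T u≢v

  m* : Matching G (lookup W)
  m* = transfer (proj₁ maximum) (mate-adj (proj₁ maximum)) (λ {z} e → trans (lookup-W z) (mate-in (proj₁ maximum) e))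

  c : ℕ
  c = ncovered (proj₁ maximum)

  count-W : count (lookup W) ≡ c + d
  count-W = trans (count-cong lookup-W) (sym (proj₂ maximum))

  no-larger : (m : Matching G (lookup W)) → ncovered m ≡ suc (suc c) → ⊥
  no-larger m size = no-defect-d-matching m′ (begin
      ncovered m + d                    ≡⟨ cong (_+ d) size ⟩
      suc (suc (c + d))                 ≡⟨ cong (λ t → suc (suc t)) (sym count-W) ⟩
      suc (suc (count (lookup W)))      ≡⟨ cong (λ t → suc (suc t)) (count-cong lookup-W) ⟩
      suc (suc (count (T∖ u v)))        ≡⟨ sym (count-T∖ u∈T v∈T u≢v) ⟩
      count T                           ∎)
    where
    open ≡-Reasoning
    m-H′ = missing-endpoint⇒deleteEdge (inj₁ (trans (lookup-W u) (T∖-left u v))) m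
    m′ : Matching H′ T
    m′ = transfer m-H′ (mate-adj m-H′) (λ {z} e → T∖⇒T (trans (sym (lookup-W z)) (mate-in m e)))

  -- Removing u and w instead of u and v: v is then isolated, so the matching lives in W - w.
  each-missed : ∀ w → lookup W w ≡ true → Σ (Matching G (lookup W)) λ m → ncovered m ≡ c × covered m w ≡ false
  each-missed w Ww = m′ , m′-size , w-uncovered
    where
    W∖w = trans (sym (lookup-W w)) Ww
    Tw = T∖⇒T W∖w
    u≢w : u ≢ w
    u≢w u≡w = T∖⇒≢₁ W∖w (sym u≡w)
    removed = matching-after-removing u∈T Tw u≢w
    m = proj₁ removed
    avoids-v : ∀ {z q} → mate m z ≡ just q → z ≢ v
    avoids-v {z} {q} mzq refl =
      v-isolated (T∖⇒T (mate-in m (mate-sym m mzq))) (T∖⇒≢₁ (mate-in m (mate-sym m mzq))) (mate-adj m mzq)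
    m′ : Matching G (lookup W)
    m′ = transfer m (mate-adj m) (λ {z} e → trans (lookup-W z)
           (T∖-intro (T∖⇒T (mate-in m e)) (T∖⇒≢₁ (mate-in m e)) (avoids-v e)))
    m′-size : ncovered m′ ≡ c
    m′-size = +-cancelʳ-≡ d _ _ (suc-injective (suc-injective (begin
        suc (suc (ncovered m + d))    ≡⟨ cong (λ t → suc (suc t)) (proj₂ removed) ⟩
        suc (suc (count (T∖ u w)))    ≡⟨ sym (count-T∖ u∈T Tw u≢w) ⟩
        count T                       ≡⟨ count-T∖ u∈T v∈T u≢v ⟩
        suc (suc (count (T∖ u v)))    ≡⟨ cong (λ t → suc (suc t)) (sym (proj₂ maximum)) ⟩
        suc (suc (c + d))             ∎)))
      where open ≡-Reasoning
    w-uncovered : covered m′ w ≡ false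
    w-uncovered with mate m w in mw
    ... | nothing = refl
    ... | just _ = ⊥-elim (true≢false (trans (sym (mate-in m mw)) (T∖-right u w)))

module Structure {N} (G : Graph N) (u v : Fin N) (uv : Edge G u v) (n k d : ℕ) (2≤n : 2 ≤ n)
  (nkd : IsNKDGraph n k d G) (S₀ : Subset N) (S₀-size : ∣ S₀ ∣ ≡ n ∸ 2)
  (M : List (Fin N × Fin N)) (M-matching : IsKMatching (deleteEdge G u v) (∁ S₀) k M)
  (stuck : ¬ (∃ λ M′ → IsDefectMatching (deleteEdge G u v) (∁ S₀) d M′ × Extends M M′)) where

  open Obstructed G u v uv n k d 2≤n nkd S₀ S₀-size M M-matching stuck
  open Gallai G W c no-larger each-missed using (missed-unique)

  S : Subset N
  S = tabulate (λ x → lookup S₀ x ∨ covers M x)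

  lookup-∁S : ∀ x → lookup (∁ S) x ≡ T x
  lookup-∁S x = trans (lookup-∁ S x) (trans (cong not (lookup∘tabulate _ x)) (de-Morgan (lookup S₀ x) (covers M x)))
    where
    de-Morgan : ∀ a b → not (a ∨ b) ≡ not a ∧ not b
    de-Morgan true b = refl
    de-Morgan false b = refl

  S-size : ∣ S ∣ ≡ n ∸ 2 + 2 * k
  S-size = trans (∣∣≡count S) (trans (count-cong (lookup∘tabulate (λ x → lookup S₀ x ∨ covers M x))) (trans (count-∨ (lookup S₀) (covers M) disjoint)
             (cong₂ _+_ (trans (sym (∣∣≡count S₀)) S₀-size) M-size)))
    where
    disjoint : ∀ x → lookup S₀ x ∧ covers M x ≡ false
    disjoint x with covers M x in c
    ... | true = trans (∧-identityʳ _) (covers⇒∉S₀ c)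
    ... | false = ∧-zeroʳ _

  M-in-S : IsKMatching G S k M
  M-in-S = IsMatching-transfer {H = H′} {G} {∁ S₀} {S} (proj₁ M-matching)
             (λ p → deleteEdge-⊆ G u v (proj₁ (All.lookup (proj₁ (proj₁ M-matching)) p)))
             (λ {x} x∈M → true⇒∈ (trans (lookup∘tabulate _ x) (trans (cong (lookup S₀ x ∨_) (∈⇒covers {M = M} x∈M)) (∨-zeroʳ _))))
         , proj₂ M-matching

  module _ {x} (Wx : lookup W x ≡ true) where
    W⇒T : T x ≡ true
    W⇒T = T∖⇒T (trans (sym (lookup-W x)) Wx)
    W⇒≢u : x ≢ u
    W⇒≢u = T∖⇒≢₁ (trans (sym (lookup-W x)) Wx)
    W⇒≢v : x ≢ v
    W⇒≢v = T∖⇒≢₂ (trans (sym (lookup-W x)) Wx)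

  T⇒W : ∀ {x} → T x ≡ true → x ≢ u → x ≢ v → lookup W x ≡ true
  T⇒W Tx x≢u x≢v = trans (lookup-W _) (T∖-intro Tx x≢u x≢v)

  module ComponentOf (p : Fin N) (Wp : lookup W p ≡ true) where
    open Component G W p public

    C : Subset N
    C = componentSet

    C⊆W : ∀ {y} → component y ≡ true → lookup W y ≡ true
    C⊆W {y} h with reach-target G (component-reach h)
    ... | inj₁ refl = Wp
    ... | inj₂ y∈W = ∈⇒true y∈W

    reach-inside : ∀ {a b} → component a ≡ true → component b ≡ true → Reach G W a b
    reach-inside ca cb = reach-trans G (reach-sym G (component-reach ca) (true⇒∈ Wp)) (component-reach cb)

    closed : (m : Matching G (lookup W)) → Closed m component
    closed m ca mab = reach-component (reach-snoc G (component-reach ca) (mate-adj m mab) (true⇒∈ (mate-in m (mate-sym m mab))))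

    -- A maximum matching missing w covers the rest of the component (Gallai), hence perfectly matches C - w.
    factor-critical : FactorCritical G C
    factor-critical w w∈C = perfect-matching-without (each-missed w (C⊆W cw))
      where
      cw = trans (sym (lookup-componentSet w)) (∈⇒true w∈C)
      perfect-matching-without : (Σ (Matching G (lookup W)) λ m → ncovered m ≡ c × covered m w ≡ false) →
        ∃ λ L → IsMatching G (C ∩ ∁ ⁅ w ⁆) L × 2 * length L ≡ ∣ C ∩ ∁ ⁅ w ⁆ ∣
      perfect-matching-without (m , size , mw) =
        L , L-matching , trans L-size (trans (count-cong all-covered) (sym (∣∣≡count (C ∩ ∁ ⁅ w ⁆))))
        where
        r = restrict m component (closed m)
        r′ : Matching G (lookup (C ∩ ∁ ⁅ w ⁆))
        r′ = transfer r (mate-adj r) (λ {x} e → trans (lookup-∩∁⁅⁆ C w x) (∧-true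
               (trans (lookup-componentSet x) (∧-trueʳ (mate-in r e)))
               (cong not (==-false (λ { refl → true≢false (trans (sym (∧-trueˡ (trans (sym (restrict-covered m _ (closed m) x))
                   (mate⇒covered r e)))) mw) })))))
        converted = toIsMatching r′ (C ∩ ∁ ⁅ w ⁆) (λ h → h)
        L = proj₁ converted
        L-matching = proj₁ (proj₂ converted)
        L-size = proj₁ (proj₂ (proj₂ converted))
        all-covered : ∀ x → covered r′ x ≡ lookup (C ∩ ∁ ⁅ w ⁆) x
        all-covered x rewrite lookup-∩∁⁅⁆ C w x | restrict-covered m _ (closed m) x | lookup-componentSet x
          with component x in cx
        ... | false = ∧-zeroʳ _
        ... | true with x ≟ w
        ... | yes refl = trans (∧-identityʳ _) mw
        ... | no x≢w with covered m x in mx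
        ... | true = refl
        ... | false = ⊥-elim (missed-unique (reach-inside cw cx) m size (C⊆W cw) (λ e → x≢w (sym e)) mw mx)

    p∈C : p ∈ C
    p∈C = true⇒∈ (trans (lookup-componentSet p) component-self)

    odd : Odd ∣ C ∣
    odd = factorCritical⇒odd {G = G} factor-critical p∈C

    isComponent : IsComponent G (∁ S) C
    isComponent = C⊆∁S , (p , p∈C) , connected , maximal
      where
      C⇒component : ∀ {x} → x ∈ C → component x ≡ true
      C⇒component {x} h = trans (sym (lookup-componentSet x)) (∈⇒true h)
      C⊆∁S : ∀ x → x ∈ C → x ∈ ∁ S
      C⊆∁S x h = true⇒∈ (trans (lookup-∁S x) (W⇒T (C⊆W (C⇒component h))))
      connected : Connected G C
      connected x y x∈C y∈C = reach-trans G (reach-sym G (reach-in-component (component-reach (C⇒component x∈C)) component-self) p∈C)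
                                (reach-in-component (component-reach (C⇒component y∈C)) component-self)
      maximal : ∀ x y → x ∈ C → y ∈ ∁ S → y ∉ C → ¬ Edge G x y
      maximal x y x∈C y∈∁S y∉C e with y ≟ u | y ≟ v
      ... | yes refl | _ = u-isolated (W⇒T Wx) (W⇒≢v Wx) (trans (adj-sym G y x) e)
        where Wx = C⊆W (C⇒component x∈C)
      ... | no _ | yes refl = v-isolated (W⇒T Wx) (W⇒≢u Wx) (trans (adj-sym G y x) e)
        where Wx = C⊆W (C⇒component x∈C)
      ... | no y≢u | no y≢v = y∉C (true⇒∈ (trans (lookup-componentSet y) (reach-component
              (reach-snoc G (component-reach (C⇒component x∈C)) e (true⇒∈ (T⇒W Ty y≢u y≢v))))))
        where Ty = trans (sym (lookup-∁S y)) (∈⇒true y∈∁S)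

  uv-part : Subset N
  uv-part = ⁅ u ⁆ ∪ ⁅ v ⁆

  u∈uv : u ∈ uv-part
  u∈uv = x∈p∪q⁺ (inj₁ (x∈⁅x⁆ u))

  v∈uv : v ∈ uv-part
  v∈uv = x∈p∪q⁺ (inj₂ (x∈⁅x⁆ v))

  ∈uv : ∀ {x} → x ∈ uv-part → x ≡ u ⊎ x ≡ v
  ∈uv h with x∈p∪q⁻ ⁅ u ⁆ ⁅ v ⁆ h
  ... | inj₁ x∈u = inj₁ (x∈⁅y⁆⇒x≡y u x∈u)
  ... | inj₂ x∈v = inj₂ (x∈⁅y⁆⇒x≡y v x∈v)

  uv-isComponent : IsComponent G (∁ S) uv-part
  uv-isComponent = ⊆∁S , (u , u∈uv) , connected , maximal
    where
    ⊆∁S : ∀ x → x ∈ uv-part → x ∈ ∁ S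
    ⊆∁S x h with ∈uv h
    ... | inj₁ refl = true⇒∈ (trans (lookup-∁S u) u∈T)
    ... | inj₂ refl = true⇒∈ (trans (lookup-∁S v) v∈T)
    connected : Connected G uv-part
    connected x y x∈ y∈ with ∈uv x∈ | ∈uv y∈
    ... | inj₁ refl | inj₁ refl = here
    ... | inj₁ refl | inj₂ refl = step uv v∈uv here
    ... | inj₂ refl | inj₁ refl = step (trans (adj-sym G v u) uv) u∈uv here
    ... | inj₂ refl | inj₂ refl = here
    maximal : ∀ x y → x ∈ uv-part → y ∈ ∁ S → y ∉ uv-part → ¬ Edge G x y
    maximal x y x∈ y∈∁S y∉ e with ∈uv x∈
    ... | inj₁ refl = u-isolated (trans (sym (lookup-∁S y)) (∈⇒true y∈∁S)) (λ { refl → y∉ v∈uv }) e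
    ... | inj₂ refl = v-isolated (trans (sym (lookup-∁S y)) (∈⇒true y∈∁S)) (λ { refl → y∉ u∈uv }) e

  missed : Fin N → Bool
  missed z = lookup W z ∧ not (covered m* z)

  count-missed : count missed ≡ d
  count-missed = +-cancelˡ-≡ c _ _ (trans (sym (count-uncovered m*)) count-W)

  uv∉W : ∀ {x} → x ∈ uv-part → lookup W x ≡ true → ⊥
  uv∉W h Wx with ∈uv h
  ... | inj₁ refl = W⇒≢u Wx refl
  ... | inj₂ refl = W⇒≢v Wx refl

  -- The component of x is odd, so m* cannot cover all of it.
  missed-in-component : ∀ {x} → lookup W x ≡ true → ∃ λ y → Component.component G W x y ≡ true × missed y ≡ true
  missed-in-component {x} Wx with any? (λ y → Component.component G W x y ∧ not (covered m* y) ≟ᵇ true)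
  ... | yes (y , h) = y , ∧-trueˡ h , ∧-true (ComponentOf.C⊆W x Wx (∧-trueˡ h)) (∧-trueʳ h)
  ... | no none = ⊥-elim (ComponentOf.odd x Wx (subst (2 ∣_) (sym (trans (∣∣≡count (ComponentOf.C x Wx))
                    (count-cong (Component.lookup-componentSet G W x))))
                    (closed-covered-even m* _ (ComponentOf.closed x Wx m*) all-covered)))
    where
    all-covered : ∀ y → Component.component G W x y ≡ true → covered m* y ≡ true
    all-covered y cy with covered m* y in my
    ... | true = refl
    ... | false = ⊥-elim (none (y , cong₂ (λ a b → a ∧ not b) cy my))

  -- Each component of G[W] contains exactly one vertex missed by m*: at most one by Gallai, at least one by parity,
  -- so listing the d missed vertices lists the components.
  module _ (g : Fin d → Fin N) (g-injective : ∀ i j → g i ≡ g j → i ≡ j) (g-missed : ∀ i → missed (g i) ≡ true)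
    (g-onto : ∀ y → missed y ≡ true → ∃ λ i → g i ≡ y) where

    Wg : ∀ i → lookup W (g i) ≡ true
    Wg i = ∧-trueˡ (g-missed i)

    Cs : Vec (Subset N) d
    Cs = tabulate (λ i → ComponentOf.C (g i) (Wg i))

    lookup-Cs : ∀ i → lookup Cs i ≡ ComponentOf.C (g i) (Wg i)
    lookup-Cs = lookup∘tabulate _

    ∈Cs : ∀ i {x} → x ∈ lookup Cs i → Component.component G W (g i) x ≡ true
    ∈Cs i {x} h = trans (sym (Component.lookup-componentSet G W (g i) x)) (∈⇒true (subst (x ∈_) (lookup-Cs i) h))

    odd-critical : ∀ i → Odd ∣ lookup Cs i ∣ × FactorCritical G (lookup Cs i)
    odd-critical i rewrite lookup-Cs i = ComponentOf.odd (g i) (Wg i) , ComponentOf.factor-critical (g i) (Wg i)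

    isComponent : ∀ i → IsComponent G (∁ S) (lookup (uv-part ∷ Cs) i)
    isComponent zero = uv-isComponent
    isComponent (suc i) rewrite lookup-Cs i = ComponentOf.isComponent (g i) (Wg i)

    disjoint : ∀ i j → i ≢ j → Empty (lookup (uv-part ∷ Cs) i ∩ lookup (uv-part ∷ Cs) j)
    disjoint zero zero i≢j _ = i≢j refl
    disjoint zero (suc j) _ (x , h) with x∈p∩q⁻ uv-part (lookup Cs j) h
    ... | x∈uv , x∈C = uv∉W x∈uv (ComponentOf.C⊆W (g j) (Wg j) (∈Cs j x∈C))
    disjoint (suc i) zero _ (x , h) with x∈p∩q⁻ (lookup Cs i) uv-part h
    ... | x∈C , x∈uv = uv∉W x∈uv (ComponentOf.C⊆W (g i) (Wg i) (∈Cs i x∈C))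
    disjoint (suc i) (suc j) i≢j (x , h) with x∈p∩q⁻ (lookup Cs i) (lookup Cs j) h
    ... | x∈Ci , x∈Cj = missed-unique path m* refl (Wg i) (λ e → i≢j (cong suc (g-injective i j e)))
                          (not-true (∧-trueʳ (g-missed i))) (not-true (∧-trueʳ (g-missed j)))
      where
      path : Reach G W (g i) (g j)
      path = reach-trans G (Component.component-reach G W (g i) (∈Cs i x∈Ci))
               (reach-sym G (Component.component-reach G W (g j) (∈Cs j x∈Cj)) (true⇒∈ (Wg j)))

    covering : ∀ x → x ∈ ∁ S → ∃ λ i → x ∈ lookup (uv-part ∷ Cs) i
    covering x x∈∁S with x ≟ u | x ≟ v
    ... | yes refl | _ = zero , u∈uv
    ... | no _ | yes refl = zero , v∈uv
    ... | no x≢u | no x≢v = in-part-of (missed-in-component Wx)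
      where
      Wx = T⇒W (trans (sym (lookup-∁S x)) (∈⇒true x∈∁S)) x≢u x≢v
      in-part-of : (∃ λ y → Component.component G W x y ≡ true × missed y ≡ true) → ∃ λ i → x ∈ lookup (uv-part ∷ Cs) i
      in-part-of (y , cy , missed-y) with g-onto y missed-y
      ... | i , refl = suc i , subst (x ∈_) (sym (lookup-Cs i)) (true⇒∈
        (trans (Component.lookup-componentSet G W (g i) x) (Component.reach-component G W (g i)
          (reach-sym G (Component.component-reach G W x cy) (true⇒∈ Wx)))))

    partition : DisjointUnionOfComponents G (∁ S) (uv-part ∷ Cs)
    partition = isComponent , disjoint , covering

  barrier : EdgeBarrier G u v n k d
  barrier = from (subst (λ m → Σ (Fin m → Fin N) λ g → (∀ i j → g i ≡ g j → i ≡ j) × (∀ i → missed (g i) ≡ true)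
                                   × (∀ y → missed y ≡ true → ∃ λ i → g i ≡ y)) count-missed (enumerate missed))
    where
    from : (Σ (Fin d → Fin N) λ g → (∀ i j → g i ≡ g j → i ≡ j) × (∀ i → missed (g i) ≡ true)
             × (∀ y → missed y ≡ true → ∃ λ i → g i ≡ y)) → EdgeBarrier G u v n k d
    from (g , g-injective , g-missed , g-onto) =
      S , S-size , (M , M-in-S) , Cs g g-injective g-missed g-onto ,
      odd-critical g g-injective g-missed g-onto , partition g g-injective g-missed g-onto

module Deletion {N} (G : Graph N) (u v : Fin N) (n k d : ℕ) (2≤n : 2 ≤ n) (nkd : IsNKDGraph n k d G) where

  H′ : Graph N
  H′ = deleteEdge G u v

  n∸2+2 : n ∸ 2 + 2 ≡ n
  n∸2+2 = m∸n+n≡m 2≤n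

  size-condition : n ∸ 2 + 2 * k + d + 2 ≤ N
  size-condition = ≤-trans (+-monoˡ-≤ 2 (+-monoˡ-≤ d (+-monoˡ-≤ (2 * k) (m∸n≤m n 2)))) (proj₁ nkd)

  parity-condition : 2 ∣ (N ∸ (n ∸ 2) ∸ d)
  parity-condition = subst (2 ∣_) (sym two-more) (∣m∣n⇒∣m+n (n∣n {2}) (subst (2 ∣_) (∸-+-assoc N n d) (proj₁ (proj₂ nkd))))
    where
    n+d≤N : n + d ≤ N
    n+d≤N = ≤-trans (≤-trans (m≤m+n (n + d) (2 * k + 2)) (≤-reflexive (shuffle n d (2 * k)))) (proj₁ nkd)
      where
      shuffle : ∀ a b c → a + b + (c + 2) ≡ a + c + b + 2
      shuffle = solve-∀
    two-more : N ∸ (n ∸ 2) ∸ d ≡ 2 + (N ∸ (n + d))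
    two-more = begin
        N ∸ (n ∸ 2) ∸ d                              ≡⟨ ∸-+-assoc N (n ∸ 2) d ⟩
        N ∸ (n ∸ 2 + d)                              ≡⟨ cong (_∸ (n ∸ 2 + d)) N≡ ⟩
        (n ∸ 2 + d) + (2 + (N ∸ (n + d))) ∸ (n ∸ 2 + d) ≡⟨ m+n∸m≡n (n ∸ 2 + d) _ ⟩
        2 + (N ∸ (n + d))                            ∎
      where
      open ≡-Reasoning
      shuffle : ∀ a b c → a + 2 + b + c ≡ a + b + (2 + c)
      shuffle = solve-∀
      N≡ : N ≡ (n ∸ 2 + d) + (2 + (N ∸ (n + d)))
      N≡ = trans (sym (m+[n∸m]≡n n+d≤N)) (trans (cong (λ t → t + d + (N ∸ (n + d))) (sym n∸2+2)) (shuffle (n ∸ 2) d _))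

  deletable-pair : ∀ (S₀ : Subset N) → ∣ S₀ ∣ ≡ n ∸ 2 → ∃ λ p → ∃ λ q →
    lookup S₀ p ≡ false × lookup S₀ q ≡ false × p ≢ q × (lookup S₀ u ≡ true ⊎ p ≡ u)
  deletable-pair S₀ S₀-size = with-p first
    where
    outside : Fin N → Bool
    outside = lookup (∁ S₀)
    outside⇒∉ : ∀ {z} → outside z ≡ true → lookup S₀ z ≡ false
    outside⇒∉ {z} h = not-true (trans (sym (lookup-∁ S₀ z)) h)
    two-outside : 2 ≤ count outside
    two-outside = +-cancelˡ-≤ (n ∸ 2) 2 _ (begin
        n ∸ 2 + 2                 ≡⟨ n∸2+2 ⟩
        n                         ≤⟨ m≤m+n n _ ⟩
        n + (2 * k + d + 2)       ≡⟨ shuffle n (2 * k) d ⟩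
        n + 2 * k + d + 2         ≤⟨ proj₁ nkd ⟩
        N                         ≡⟨ sym (∣p∣+∣∁p∣≡n S₀) ⟩
        ∣ S₀ ∣ + ∣ ∁ S₀ ∣          ≡⟨ cong₂ _+_ S₀-size (∣∣≡count (∁ S₀)) ⟩
        n ∸ 2 + count outside     ∎)
      where
      open ≤-Reasoning
      shuffle : ∀ a b c → a + (b + c + 2) ≡ a + b + c + 2
      shuffle = solve-∀
    first : ∃ λ p → outside p ≡ true × (lookup S₀ u ≡ true ⊎ p ≡ u)
    first with lookup S₀ u in S₀u
    ... | true = proj₁ w , proj₂ w , inj₁ refl
      where w = count-witness outside (≤-trans (s≤s z≤n) two-outside)
    ... | false = u , trans (lookup-∁ S₀ u) (cong not S₀u) , inj₂ refl
    with-p : (∃ λ p → outside p ≡ true × (lookup S₀ u ≡ true ⊎ p ≡ u)) → ∃ λ p → ∃ λ q →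
      lookup S₀ p ≡ false × lookup S₀ q ≡ false × p ≢ q × (lookup S₀ u ≡ true ⊎ p ≡ u)
    with-p (p , p-out , u-deleted) = with-q (count-witness (λ z → outside z ∧ not (z == p))
      (s≤s⁻¹ (≤-trans two-outside (≤-reflexive (count-remove outside p p-out)))))
      where
      with-q : (∃ λ q → outside q ∧ not (q == p) ≡ true) → ∃ λ p → ∃ λ q →
        lookup S₀ p ≡ false × lookup S₀ q ≡ false × p ≢ q × (lookup S₀ u ≡ true ⊎ p ≡ u)
      with-q (q , q-out) = p , q , outside⇒∉ p-out , outside⇒∉ (∧-trueˡ q-out) , p≢q , u-deleted
        where
        p≢q : p ≢ q
        p≢q refl rewrite ==-refl p = true≢false (trans (sym q-out) (∧-zeroʳ _))

  -- With u among the n deleted vertices, the k-matching G provides avoids u and so lives in G - uv.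
  k-matching-after-deleting : ∀ (S₀ : Subset N) → ∣ S₀ ∣ ≡ n ∸ 2 → ∀ {p q} → lookup S₀ p ≡ false → lookup S₀ q ≡ false →
    p ≢ q → (lookup S₀ u ≡ true ⊎ p ≡ u) → ∃ λ M → IsKMatching H′ (∁ S₀) k M
  k-matching-after-deleting S₀ S₀-size {p} {q} S₀p S₀q p≢q u-deleted =
    M , IsMatching-transfer {H = G} {H′} {∁ Z} {∁ S₀} (proj₁ M-matching) edge′ in′ , proj₂ M-matching
    where
    Z = addTwo S₀ p q
    Z-size : ∣ Z ∣ ≡ n
    Z-size = trans (∣addTwo∣ S₀ S₀p S₀q p≢q) (trans (cong (_+ 2) S₀-size) n∸2+2)
    k-matching = proj₁ (proj₂ (proj₂ nkd) Z Z-size)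
    M = proj₁ k-matching
    M-matching = proj₂ k-matching
    ∁Z⇒ : ∀ {z} → z ∈ ∁ Z → not (lookup S₀ z) ∧ avoiding p q z ≡ true
    ∁Z⇒ {z} h = trans (sym (lookup-∁addTwo S₀ z)) (∈⇒true h)
    ∁Z⇒≢u : ∀ {z} → z ∈ ∁ Z → z ≢ u
    ∁Z⇒≢u h refl = deleted u-deleted
      where
      deleted : (lookup S₀ u ≡ true ⊎ p ≡ u) → ⊥
      deleted (inj₁ S₀u) = true≢false (trans (sym (∁Z⇒ h)) (cong (λ b → not b ∧ avoiding p q u) S₀u))
      deleted (inj₂ refl) = true≢false (trans (sym (∁Z⇒ h)) (trans (cong (not (lookup S₀ p) ∧_) (avoiding-left p q)) (∧-zeroʳ _)))
    edge′ : ∀ {x y} → (x , y) Mem.∈ M → adj H′ x y ≡ true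
    edge′ xy∈M with All.lookup (proj₁ (proj₁ M-matching)) xy∈M
    ... | e , x∈ , y∈ = deleteEdge-keeps G u v e (inj₁ (∁Z⇒≢u x∈)) (inj₂ (∁Z⇒≢u y∈))
    in′ : ∀ {x} → x Mem.∈ endpoints M → x ∈ ∁ S₀
    in′ x∈M = true⇒∈ (trans (lookup-∁ S₀ _) (∧-trueˡ (∁Z⇒ (endpoint-in {H = G} (proj₁ M-matching) x∈M))))

  k-matching-exists : ∀ (S₀ : Subset N) → ∣ S₀ ∣ ≡ n ∸ 2 → ∃ λ M → IsKMatching H′ (∁ S₀) k M
  k-matching-exists S₀ S₀-size with deletable-pair S₀ S₀-size
  ... | p , q , S₀p , S₀q , p≢q , u-deleted = k-matching-after-deleting S₀ S₀-size S₀p S₀q p≢q u-deleted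

  -- Size, parity and k-matchings survive the deletion, so only an extension can fail.
  ¬NKD⇒obstruction : ¬ IsNKDGraph (n ∸ 2) k d H′ → Obstruction H′ (n ∸ 2) k d
  ¬NKD⇒obstruction ¬nkd with obstruction? H′ (n ∸ 2) k d
  ... | yes obstruction = obstruction
  ... | no none = ⊥-elim (¬nkd (size-condition , parity-condition , λ S₀ S₀-size → k-matching-exists S₀ S₀-size , extends S₀ S₀-size))
    where
    extends : ∀ S₀ → ∣ S₀ ∣ ≡ n ∸ 2 → ∀ M → IsKMatching H′ (∁ S₀) k M →
      ∃ λ M′ → IsDefectMatching H′ (∁ S₀) d M′ × Extends M M′
    extends S₀ S₀-size M M-matching with extendsToDefect? H′ (∁ S₀) d M
    ... | yes extension = extension
    ... | no stuck = ⊥-elim (none (S₀ , S₀-size , M , M-matching , stuck))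

theorem4p1 : ∀ (n k d : ℕ) → 2 ≤ n → ∀ {N : ℕ} (G : Graph N) → IsNKDGraph n k d G →
    ∀ (u v : Fin N) → Edge G u v →
    (¬ IsNKDGraph (n ∸ 2) k d (deleteEdge G u v))
    ⇔ (∃ λ (S : Subset N) → ∣ S ∣ ≡ n ∸ 2 + 2 * k
        × (∃ λ M → IsKMatching G S k M)
        × (∃ λ (Cs : Vec (Subset N) d) →
             (∀ i → Odd ∣ lookup Cs i ∣ × FactorCritical G (lookup Cs i))
             × DisjointUnionOfComponents G (∁ S) ((⁅ u ⁆ ∪ ⁅ v ⁆) ∷ Cs)))
theorem4p1 n k d 2≤n G nkd u v uv = mk⇔ necessary (barrier⇒¬NKD G u v uv n k d)
  where
  necessary : ¬ IsNKDGraph (n ∸ 2) k d (deleteEdge G u v) → EdgeBarrier G u v n k d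
  necessary ¬nkd with Deletion.¬NKD⇒obstruction G u v n k d 2≤n nkd ¬nkd
  ... | S₀ , S₀-size , M , M-matching , stuck = Structure.barrier G u v uv n k d 2≤n nkd S₀ S₀-size M M-matching stuck
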